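{- (1) The theory $SA$ is interpretable in $Ar+(AC!)$: there is a translation $\varphi\mapsto\varphi^\wedge$ of formulas of $SA$ into formulas of $Ar$ such that $SA\vdash\varphi$ implies $Ar+(AC!)\vdash\overline{\overline{\varphi}}^\wedge$ (where $\overline{\overline{\varphi}}$ is the universal closure of $\varphi$). (2) The theory $Ar+(AC!)$ is a subtheory of $Ar+(\Delta^1_1\text{ - }C)$, i.e. every theorem of $Ar+(AC!)$ is a theorem of $Ar+(\Delta^1_1\text{ - }C)$.
   Context: Fix a standard numbering of pairs of natural numbers, $(m,n)$ denoting the number of the pair $m,n$. $SA$: a classical many-sorted second-order arithmetic. Variables: numerical variables $n_1,n_2,\ldots,m,n,\ldots$, and for each $k\geqslant1$ set variables $x_1^{(k)},x_2^{(k)},\ldots$ of sort $k$. Constants $0,1$, function symbols $+,\cdot$, predicate symbols $=$ (for numbers) and $\in_k$ $(k\geqslant1)$. Atomic formulas: $t=\tau$ and $t\in_k x^{(k)}$ for numerical terms $t,\tau$; formulas built with $\bot$, connectives, quantifiers. A formula is $k$-simple if it has no quantifiers over set variables and no variables of sort $>k$. Axioms: classical predicate logic with equality; Peano axioms $\neg(n+1=0)$, $n+1=m+1\supset n=m$, $n+0=n$, $n+(m+1)=(n+m)+1$, $n\cdot0=0$, $n\cdot(m+1)=n\cdot m+n$; induction $\varphi(0)\wedge\forall n[\varphi(n)\supset\varphi(n+1)]\supset\forall n\varphi(n)$ for every formula $\varphi$; comprehension $\exists z^{(k)}\forall n(n\in z\equiv\varphi(n))$ for $k$-simple $\varphi$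 not containing $z^{(k)}$; choice $\forall n\exists!x^{(k)}\varphi(n,x)\supset\exists y^{(k+1)}\forall n\exists x^{(k)}[\varphi(n,x)\wedge\forall m(m\in x\equiv(n,m)\in y)]$ for $k$-simple $\varphi$ (uniqueness being with respect to $x=_ky:=\forall n(n\in_kx\equiv n\in_ky)$). $Ar$: classical second-order arithmetic with numerical variables and one sort of set variables $x,y,\ldots$, constants $0,1$, symbols $+,\cdot,=,\in$; axioms: classical logic with equality, the Peano axioms above, induction for all formulas, and comprehension $\exists z\forall n(n\in z\equiv\varphi(n))$ for $\varphi$ without set quantifiers not containing $z$. Set equality $x=y:=\forall n(n\in x\equiv n\in y)$. $(AC!)$: $\forall k\exists!x\varphi(k,x)\supset\exists y\forall k\exists x[\varphi(k,x)\wedge\forall m(m\in x\equiv(k,m)\in y)]$, for $\varphi$ without set quantifiers not containing $y$. $(\Delta^1_1\text{ - }C)$: $\forall n[\forall v\varphi(n,v)\equiv\exists u\psi(n,u)]\supset\exists z\forall n[n\in z\equiv\exists u\psi(n,u)]$, for $\varphi,\psi$ without set quantifiers not containing $z$. -}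

module Defs where

open import Data.Nat using (ℕ; zero; suc; _≤_)
open import Data.Unit using (⊤; tt)
open import Data.Empty using (⊥)
open import Data.Product using (_×_; _,_)
open import Data.Sum using (_⊎_)
open import Data.List using (List; []; _∷_; map)
open import Data.List.Membership.Propositional using (_∈_)

-- SA uses S = ℕ, where the index i stands for
-- the sort i+1 (sorts are k ≥ 1); Ar uses S = ⊤ (a single set sort).

data Sort (S : Set) : Set where
  num : Sort S
  set : S → Sort S

Ctx : Set → Set
Ctx S = List (Sort S)

infix 4 _∋_
data _∋_ {S : Set} : Ctx S → Sort S → Set where
  here  : ∀ {Γ σ} → (σ ∷ Γ) ∋ σ
  there : ∀ {Γ σ τ} → Γ ∋ σ → (τ ∷ Γ) ∋ σ

infixl 7 _`*_
infixl 6 _`+_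
data Tm {S : Set} (Γ : Ctx S) : Set where
  var   : Γ ∋ num → Tm Γ
  `0 `1 : Tm Γ
  _`+_ _`*_ : Tm Γ → Tm Γ → Tm Γ

infix 4 _≐_ _∈ₛ_
infixr 3 _∧'_
infixr 2 _∨'_
infixr 1 _⇒_ _⇔_
data Fm {S : Set} (Γ : Ctx S) : Set where
  _≐_  : Tm Γ → Tm Γ → Fm Γ
  _∈ₛ_ : ∀ {s} → Tm Γ → Γ ∋ set s → Fm Γ
  ⊥'   : Fm Γ
  _⇒_ _∧'_ _∨'_ : Fm Γ → Fm Γ → Fm Γ
  All Ex : (σ : Sort S) → Fm (σ ∷ Γ) → Fm Γ

¬' : ∀ {S} {Γ : Ctx S} → Fm Γ → Fm Γ
¬' φ = φ ⇒ ⊥'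

_⇔_ : ∀ {S} {Γ : Ctx S} → Fm Γ → Fm Γ → Fm Γ
φ ⇔ ψ = (φ ⇒ ψ) ∧' (ψ ⇒ φ)

Ren : ∀ {S} → Ctx S → Ctx S → Set
Ren Γ Δ = ∀ {σ} → Γ ∋ σ → Δ ∋ σ

ext : ∀ {S} {Γ Δ : Ctx S} {τ} → Ren Γ Δ → Ren (τ ∷ Γ) (τ ∷ Δ)
ext ρ here      = here
ext ρ (there x) = there (ρ x)

renT : ∀ {S} {Γ Δ : Ctx S} → Ren Γ Δ → Tm Γ → Tm Δ
renT ρ (var x)   = var (ρ x)
renT ρ `0        = `0
renT ρ `1        = `1
renT ρ (t `+ u)  = renT ρ t `+ renT ρ u
renT ρ (t `* u)  = renT ρ t `* renT ρ u

renF : ∀ {S} {Γ Δ : Ctx S} → Ren Γ Δ → Fm Γ → Fm Δ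
renF ρ (t ≐ u)   = renT ρ t ≐ renT ρ u
renF ρ (t ∈ₛ x)  = renT ρ t ∈ₛ ρ x
renF ρ ⊥'        = ⊥'
renF ρ (φ ⇒ ψ)   = renF ρ φ ⇒ renF ρ ψ
renF ρ (φ ∧' ψ)  = renF ρ φ ∧' renF ρ ψ
renF ρ (φ ∨' ψ)  = renF ρ φ ∨' renF ρ ψ
renF ρ (All σ φ) = All σ (renF (ext ρ) φ)
renF ρ (Ex σ φ)  = Ex σ (renF (ext ρ) φ)

wk : ∀ {S} {Γ : Ctx S} {τ} → Fm Γ → Fm (τ ∷ Γ)
wk = renF there

Val : ∀ {S} → Ctx S → Sort S → Set
Val Γ num     = Tm Γ
Val Γ (set s) = Γ ∋ set s

renV : ∀ {S} {Γ Δ : Ctx S} → Ren Γ Δ → (σ : Sort S) → Val Γ σ → Val Δ σ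
renV ρ num     t = renT ρ t
renV ρ (set s) x = ρ x

varV : ∀ {S} {Γ : Ctx S} (σ : Sort S) → Γ ∋ σ → Val Γ σ
varV num     x = var x
varV (set s) x = x

Sub : ∀ {S} → Ctx S → Ctx S → Set
Sub Γ Δ = ∀ {σ} → Γ ∋ σ → Val Δ σ

extS : ∀ {S} {Γ Δ : Ctx S} {τ} → Sub Γ Δ → Sub (τ ∷ Γ) (τ ∷ Δ)
extS {τ = τ} θ here           = varV τ here
extS θ (there {σ = σ} x)      = renV there σ (θ x)

subT : ∀ {S} {Γ Δ : Ctx S} → Sub Γ Δ → Tm Γ → Tm Δ
subT θ (var x)  = θ x
subT θ `0       = `0
subT θ `1       = `1
subT θ (t `+ u) = subT θ t `+ subT θ u
subT θ (t `* u) = subT θ t `* subT θ u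

subF : ∀ {S} {Γ Δ : Ctx S} → Sub Γ Δ → Fm Γ → Fm Δ
subF θ (t ≐ u)   = subT θ t ≐ subT θ u
subF θ (t ∈ₛ x)  = subT θ t ∈ₛ θ x
subF θ ⊥'        = ⊥'
subF θ (φ ⇒ ψ)   = subF θ φ ⇒ subF θ ψ
subF θ (φ ∧' ψ)  = subF θ φ ∧' subF θ ψ
subF θ (φ ∨' ψ)  = subF θ φ ∨' subF θ ψ
subF θ (All σ φ) = All σ (subF (extS θ) φ)
subF θ (Ex σ φ)  = Ex σ (subF (extS θ) φ)

sub0 : ∀ {S} {Γ : Ctx S} {σ} → Val Γ σ → Sub (σ ∷ Γ) Γ
sub0 v here              = v
sub0 v (there {σ = σ} x) = varV σ x

_[_] : ∀ {S} {Γ : Ctx S} {σ} → Fm (σ ∷ Γ) → Val Γ σ → Fm Γ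
φ [ v ] = subF (sub0 v) φ

Theory : Set → Set₁
Theory S = (Γ : Ctx S) → Fm Γ → Set

data Pf {S : Set} (T : Theory S) : (Γ : Ctx S) → List (Fm Γ) → Fm Γ → Set where
  ax   : ∀ {Γ Δ φ} → T Γ φ → Pf T Γ Δ φ
  hyp  : ∀ {Γ Δ φ} → φ ∈ Δ → Pf T Γ Δ φ
  ⇒I   : ∀ {Γ Δ φ ψ} → Pf T Γ (φ ∷ Δ) ψ → Pf T Γ Δ (φ ⇒ ψ)
  ⇒E   : ∀ {Γ Δ φ ψ} → Pf T Γ Δ (φ ⇒ ψ) → Pf T Γ Δ φ → Pf T Γ Δ ψ
  ∧I   : ∀ {Γ Δ φ ψ} → Pf T Γ Δ φ → Pf T Γ Δ ψ → Pf T Γ Δ (φ ∧' ψ)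
  ∧E₁  : ∀ {Γ Δ φ ψ} → Pf T Γ Δ (φ ∧' ψ) → Pf T Γ Δ φ
  ∧E₂  : ∀ {Γ Δ φ ψ} → Pf T Γ Δ (φ ∧' ψ) → Pf T Γ Δ ψ
  ∨I₁  : ∀ {Γ Δ φ ψ} → Pf T Γ Δ φ → Pf T Γ Δ (φ ∨' ψ)
  ∨I₂  : ∀ {Γ Δ φ ψ} → Pf T Γ Δ ψ → Pf T Γ Δ (φ ∨' ψ)
  ∨E   : ∀ {Γ Δ φ ψ χ} → Pf T Γ Δ (φ ∨' ψ) → Pf T Γ (φ ∷ Δ) χ → Pf T Γ (ψ ∷ Δ) χ
         → Pf T Γ Δ χ
  -- classical reductio ad absurdum (includes ex falso)
  raa  : ∀ {Γ Δ φ} → Pf T Γ (¬' φ ∷ Δ) ⊥' → Pf T Γ Δ φ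
  ∀I   : ∀ {Γ Δ σ φ} → Pf T (σ ∷ Γ) (map wk Δ) φ → Pf T Γ Δ (All σ φ)
  ∀E   : ∀ {Γ Δ σ φ} → Pf T Γ Δ (All σ φ) → (v : Val Γ σ) → Pf T Γ Δ (φ [ v ])
  ∃I   : ∀ {Γ Δ σ φ} (v : Val Γ σ) → Pf T Γ Δ (φ [ v ]) → Pf T Γ Δ (Ex σ φ)
  ∃E   : ∀ {Γ Δ σ φ χ} → Pf T Γ Δ (Ex σ φ) → Pf T (σ ∷ Γ) (φ ∷ map wk Δ) (wk χ)
         → Pf T Γ Δ χ
  =refl  : ∀ {Γ Δ} (t : Tm Γ) → Pf T Γ Δ (t ≐ t)
  =subst : ∀ {Γ Δ t u} (φ : Fm (num ∷ Γ)) → Pf T Γ Δ (t ≐ u) → Pf T Γ Δ (φ [ t ])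
           → Pf T Γ Δ (φ [ u ])

_⊢_ : ∀ {S} {Γ : Ctx S} → Theory S → Fm Γ → Set
_⊢_ {Γ = Γ} T φ = Pf T Γ [] φ

close : ∀ {S} (Γ : Ctx S) → Fm Γ → Fm {S} []
close []      φ = φ
close (σ ∷ Γ) φ = close Γ (All σ φ)

v0 : ∀ {S} {Γ : Ctx S} {σ} → (σ ∷ Γ) ∋ σ
v0 = here

v1 : ∀ {S} {Γ : Ctx S} {σ τ} → (τ ∷ σ ∷ Γ) ∋ σ
v1 = there here

skip1 : ∀ {S} {Γ : Ctx S} {σ τ} → Ren (σ ∷ Γ) (σ ∷ τ ∷ Γ)
skip1 = ext there

-- the standard (Cantor) numbering of pairs:  (n,m) = (n+m)(n+m+1)/2 + m;
-- the formula  (t,u) ∈ y  abbreviates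
--   ∃p ( p + p = (t+u)·(t+u+1) + u + u  ∧  p ∈ y )
pair∈ : ∀ {S} {Γ : Ctx S} {s} → Tm Γ → Tm Γ → Γ ∋ set s → Fm Γ
pair∈ t u y =
  Ex num ((var v0 `+ var v0 ≐ (t' `+ u') `* (t' `+ u' `+ `1) `+ u' `+ u')
          ∧' (var v0 ∈ₛ there y))
  where
  t' = renT there t
  u' = renT there u

setEq : ∀ {S} {Γ : Ctx S} {s} → Γ ∋ set s → Γ ∋ set s → Fm Γ
setEq x y = All num ((var v0 ∈ₛ there x) ⇔ (var v0 ∈ₛ there y))

ExU : ∀ {S} {Γ : Ctx S} (s : S) → Fm (set s ∷ Γ) → Fm Γ
ExU s φ = Ex (set s) (φ ∧' All (set s) (renF skip1 φ ⇒ setEq v1 v0))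

NoSetQ : ∀ {S} {Γ : Ctx S} → Fm Γ → Set
NoSetQ (t ≐ u)         = ⊤
NoSetQ (t ∈ₛ x)        = ⊤
NoSetQ ⊥'              = ⊤
NoSetQ (φ ⇒ ψ)         = NoSetQ φ × NoSetQ ψ
NoSetQ (φ ∧' ψ)        = NoSetQ φ × NoSetQ ψ
NoSetQ (φ ∨' ψ)        = NoSetQ φ × NoSetQ ψ
NoSetQ (All num φ)     = NoSetQ φ
NoSetQ (All (set s) φ) = ⊥
NoSetQ (Ex num φ)      = NoSetQ φ
NoSetQ (Ex (set s) φ)  = ⊥

SortsBelow : ∀ {Γ : Ctx ℕ} → ℕ → Fm Γ → Set
SortsBelow k (t ≐ u)            = ⊤
SortsBelow k (_∈ₛ_ {s} t x)     = s ≤ k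
SortsBelow k ⊥'                 = ⊤
SortsBelow k (φ ⇒ ψ)            = SortsBelow k φ × SortsBelow k ψ
SortsBelow k (φ ∧' ψ)           = SortsBelow k φ × SortsBelow k ψ
SortsBelow k (φ ∨' ψ)           = SortsBelow k φ × SortsBelow k ψ
SortsBelow k (All num φ)        = SortsBelow k φ
SortsBelow k (All (set s) φ)    = s ≤ k × SortsBelow k φ
SortsBelow k (Ex num φ)         = SortsBelow k φ
SortsBelow k (Ex (set s) φ)     = s ≤ k × SortsBelow k φ

-- k-simple (with index k standing for sort k+1)
Simple : ∀ {Γ : Ctx ℕ} → ℕ → Fm Γ → Set
Simple k φ = NoSetQ φ × SortsBelow k φ

module _ {S : Set} {Γ : Ctx S} where

  peano1 peano2 peano3 peano4 peano5 peano6 : Fm Γ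
  peano1 = All num (¬' (var v0 `+ `1 ≐ `0))
  peano2 = All num (All num ((var v1 `+ `1 ≐ var v0 `+ `1) ⇒ (var v1 ≐ var v0)))
  peano3 = All num (var v0 `+ `0 ≐ var v0)
  peano4 = All num (All num (var v1 `+ (var v0 `+ `1) ≐ (var v1 `+ var v0) `+ `1))
  peano5 = All num (var v0 `* `0 ≐ `0)
  peano6 = All num (All num (var v1 `* (var v0 `+ `1) ≐ var v1 `* var v0 `+ var v1))

  Ind : Fm (num ∷ Γ) → Fm Γ
  Ind φ = (φ [ `0 ] ∧' All num (φ ⇒ subF succ φ)) ⇒ All num φ
    where
    succ : Sub (num ∷ Γ) (num ∷ Γ)
    succ here               = var here `+ `1
    succ (there {σ = σ} x)  = varV σ (there x)

  Comp : (s : S) → Fm (num ∷ Γ) → Fm Γ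
  Comp s φ = Ex (set s) (All num ((var v0 ∈ₛ v1) ⇔ renF skip1 φ))

  Choice : (s s' : S) → Fm (set s ∷ num ∷ Γ) → Fm Γ
  Choice s s' φ =
    All num (ExU s φ) ⇒
    Ex (set s') (All num (Ex (set s)
      (renF ρ φ ∧' All num ((var v0 ∈ₛ v1) ⇔ pair∈ (var (there (there here))) (var v0)
                                                   (there (there (there here)))))))
    where
    ρ : Ren (set s ∷ num ∷ Γ) (set s ∷ num ∷ set s' ∷ Γ)
    ρ = ext (ext there)

  D11C : (s : S) → Fm (set s ∷ num ∷ Γ) → Fm (set s ∷ num ∷ Γ) → Fm Γ
  D11C s φ ψ =
    All num (All (set s) φ ⇔ Ex (set s) ψ) ⇒
    Ex (set s) (All num ((var v0 ∈ₛ v1) ⇔ Ex (set s) (renF (ext (ext there)) ψ)))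

data SA : Theory ℕ where
  p1 : ∀ {Γ} → SA Γ peano1
  p2 : ∀ {Γ} → SA Γ peano2
  p3 : ∀ {Γ} → SA Γ peano3
  p4 : ∀ {Γ} → SA Γ peano4
  p5 : ∀ {Γ} → SA Γ peano5
  p6 : ∀ {Γ} → SA Γ peano6
  ind    : ∀ {Γ} (φ : Fm (num ∷ Γ)) → SA Γ (Ind φ)
  comp   : ∀ {Γ} (k : ℕ) (φ : Fm (num ∷ Γ)) → Simple k φ → SA Γ (Comp k φ)
  choice : ∀ {Γ} (k : ℕ) (φ : Fm (set k ∷ num ∷ Γ)) → Simple k φ
           → SA Γ (Choice k (suc k) φ)

data Ar : Theory ⊤ where
  p1 : ∀ {Γ} → Ar Γ peano1
  p2 : ∀ {Γ} → Ar Γ peano2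
  p3 : ∀ {Γ} → Ar Γ peano3
  p4 : ∀ {Γ} → Ar Γ peano4
  p5 : ∀ {Γ} → Ar Γ peano5
  p6 : ∀ {Γ} → Ar Γ peano6
  ind    : ∀ {Γ} (φ : Fm (num ∷ Γ)) → Ar Γ (Ind φ)
  comp   : ∀ {Γ} (φ : Fm (num ∷ Γ)) → NoSetQ φ → Ar Γ (Comp tt φ)

data AC! : Theory ⊤ where
  ac : ∀ {Γ} (φ : Fm (set tt ∷ num ∷ Γ)) → NoSetQ φ → AC! Γ (Choice tt tt φ)

data Δ¹₁-C : Theory ⊤ where
  d11 : ∀ {Γ} (φ ψ : Fm (set tt ∷ num ∷ Γ)) → NoSetQ φ → NoSetQ ψ
        → Δ¹₁-C Γ (D11C tt φ ψ)

_+ₜ_ : ∀ {S} → Theory S → Theory S → Theory S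
(T +ₜ U) Γ φ = T Γ φ ⊎ U Γ φ

eraseS : Sort ℕ → Sort ⊤
eraseS num     = num
eraseS (set _) = set tt

eraseC : Ctx ℕ → Ctx ⊤
eraseC = map eraseS

eraseV : ∀ {Γ σ} → Γ ∋ σ → eraseC Γ ∋ eraseS σ
eraseV here      = here
eraseV (there x) = there (eraseV x)

eraseT : ∀ {Γ} → Tm Γ → Tm (eraseC Γ)
eraseT (var x)  = var (eraseV x)
eraseT `0       = `0
eraseT `1       = `1
eraseT (t `+ u) = eraseT t `+ eraseT u
eraseT (t `* u) = eraseT t `* eraseT u

_^ : ∀ {Γ} → Fm Γ → Fm (eraseC Γ)
(t ≐ u) ^   = eraseT t ≐ eraseT u
(t ∈ₛ x) ^  = eraseT t ∈ₛ eraseV x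
⊥' ^        = ⊥'
(φ ⇒ ψ) ^   = (φ ^) ⇒ (ψ ^)
(φ ∧' ψ) ^  = (φ ^) ∧' (ψ ^)
(φ ∨' ψ) ^  = (φ ^) ∨' (ψ ^)
All σ φ ^   = All (eraseS σ) (φ ^)
Ex σ φ ^    = Ex (eraseS σ) (φ ^)

-- (1) Erasing sort indices sends every SA axiom to an axiom of Ar + (AC!):
-- k-simple comprehension and choice only need the absence of set quantifiers,
-- which erasure preserves, and erasure commutes with substitution, so SA
-- derivations translate rule by rule.
-- (2) Under ∀n ∃!x φ(n,x) the Σ¹₁ formula ∃u ∃k,m [t = (k,m) ∧ φ(k,u) ∧ m ∈ u]
-- and the Π¹₁ formula ∀v [t is a pair ∧ ∀k,m (t = (k,m) ∧ φ(k,v) ⊃ m ∈ v)]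
-- are equivalent: both say t = (k,m) with m in the unique x such that φ(k,x).
-- Δ¹₁-comprehension thus gives the set y of such t, whose k-th row is that x.
-- Inside Ar this needs only that the Cantor pairing is total and injective.

module Submission where

open import Defs
open import Data.Nat using (ℕ; zero; suc)
open import Data.Unit using (⊤; tt)
open import Data.Product using (_×_; _,_)
open import Data.Sum using (inj₁; inj₂)
open import Data.List using (List; []; _∷_; map)
open import Data.List.Membership.Propositional using (_∈_)
open import Data.List.Membership.Propositional.Properties using (∈-map⁺)
import Data.List.Relation.Unary.Any as Any
open import Data.Vec using (Vec; []; _∷_)
open import Relation.Binary.PropositionalEquality
  using (_≡_; refl; sym; trans; cong; cong₂; subst; subst₂)

module _ {S : Set} where

  subV : {Γ Δ : Ctx S} → Sub Γ Δ → (σ : Sort S) → Val Γ σ → Val Δ σ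
  subV θ num     t = subT θ t
  subV θ (set s) x = θ x

  infixr 9 _∘ₛ_
  _∘ₛ_ : {Γ Δ Ξ : Ctx S} → Sub Δ Ξ → Sub Γ Δ → Sub Γ Ξ
  (θ ∘ₛ θ') {σ} x = subV θ σ (θ' x)

  ren⇒sub : {Γ Δ : Ctx S} → Ren Γ Δ → Sub Γ Δ
  ren⇒sub ρ {σ} x = varV σ (ρ x)

  idₛ : {Γ : Ctx S} → Sub Γ Γ
  idₛ {σ = σ} x = varV σ x

  infix 4 _≗ₛ_
  _≗ₛ_ : {Γ Δ : Ctx S} → Sub Γ Δ → Sub Γ Δ → Set
  θ ≗ₛ θ' = ∀ {σ} x → θ {σ} x ≡ θ' {σ} x

  subV-varV : {Γ Δ : Ctx S} (θ : Sub Γ Δ) (σ : Sort S) (x : Γ ∋ σ) →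
              subV θ σ (varV σ x) ≡ θ x
  subV-varV θ num     x = refl
  subV-varV θ (set s) x = refl

  renV-varV : {Γ Δ : Ctx S} (ρ : Ren Γ Δ) (σ : Sort S) (x : Γ ∋ σ) →
              renV ρ σ (varV σ x) ≡ varV σ (ρ x)
  renV-varV ρ num     x = refl
  renV-varV ρ (set s) x = refl

  subT-cong : {Γ Δ : Ctx S} {θ θ' : Sub Γ Δ} → θ ≗ₛ θ' → (t : Tm Γ) → subT θ t ≡ subT θ' t
  subT-cong e (var x)  = e x
  subT-cong e `0       = refl
  subT-cong e `1       = refl
  subT-cong e (t `+ u) = cong₂ _`+_ (subT-cong e t) (subT-cong e u)
  subT-cong e (t `* u) = cong₂ _`*_ (subT-cong e t) (subT-cong e u)

  subT-id : {Γ : Ctx S} {θ : Sub Γ Γ} → θ ≗ₛ idₛ → (t : Tm Γ) → subT θ t ≡ t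
  subT-id e (var x)  = e x
  subT-id e `0       = refl
  subT-id e `1       = refl
  subT-id e (t `+ u) = cong₂ _`+_ (subT-id e t) (subT-id e u)
  subT-id e (t `* u) = cong₂ _`*_ (subT-id e t) (subT-id e u)

  subT-∘ : {Γ Δ Ξ : Ctx S} (θ : Sub Δ Ξ) (θ' : Sub Γ Δ) (t : Tm Γ) →
           subT θ (subT θ' t) ≡ subT (θ ∘ₛ θ') t
  subT-∘ θ θ' (var x)  = refl
  subT-∘ θ θ' `0       = refl
  subT-∘ θ θ' `1       = refl
  subT-∘ θ θ' (t `+ u) = cong₂ _`+_ (subT-∘ θ θ' t) (subT-∘ θ θ' u)
  subT-∘ θ θ' (t `* u) = cong₂ _`*_ (subT-∘ θ θ' t) (subT-∘ θ θ' u)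

  renT-as-sub : {Γ Δ : Ctx S} (ρ : Ren Γ Δ) (t : Tm Γ) → renT ρ t ≡ subT (ren⇒sub ρ) t
  renT-as-sub ρ (var x)  = refl
  renT-as-sub ρ `0       = refl
  renT-as-sub ρ `1       = refl
  renT-as-sub ρ (t `+ u) = cong₂ _`+_ (renT-as-sub ρ t) (renT-as-sub ρ u)
  renT-as-sub ρ (t `* u) = cong₂ _`*_ (renT-as-sub ρ t) (renT-as-sub ρ u)

  subV-ren⇒sub : {Γ Δ : Ctx S} (ρ : Ren Γ Δ) (σ : Sort S) (v : Val Γ σ) →
                 subV (ren⇒sub ρ) σ v ≡ renV ρ σ v
  subV-ren⇒sub ρ num     t = sym (renT-as-sub ρ t)
  subV-ren⇒sub ρ (set s) x = refl

  subT-sub0-wk : {Γ : Ctx S} {σ : Sort S} (v : Val Γ σ) (t : Tm Γ) →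
                 subT (sub0 v) (renT there t) ≡ t
  subT-sub0-wk v t = trans (cong (subT (sub0 v)) (renT-as-sub there t))
    (trans (subT-∘ (sub0 v) (ren⇒sub there) t)
           (subT-id (λ {σ} x → subV-varV (sub0 v) σ (there x)) t))

  subV-sub0-wk : {Γ : Ctx S} {τ : Sort S} (v : Val Γ τ) (σ : Sort S) (w : Val Γ σ) →
                 subV (sub0 v) σ (renV there σ w) ≡ w
  subV-sub0-wk v num     t = subT-sub0-wk v t
  subV-sub0-wk v (set s) x = refl

  subT-extS-wk : {Γ Δ : Ctx S} {τ : Sort S} (θ : Sub Γ Δ) (t : Tm Γ) →
                 subT (extS {τ = τ} θ) (renT there t) ≡ renT there (subT θ t)
  subT-extS-wk θ t = trans (cong (subT (extS θ)) (renT-as-sub there t))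
    (trans (subT-∘ (extS θ) (ren⇒sub there) t)
    (trans (subT-cong (λ {σ} x → trans (subV-varV (extS θ) σ (there x))
                                        (sym (subV-ren⇒sub there σ (θ x)))) t)
    (trans (sym (subT-∘ (ren⇒sub there) θ t))
           (sym (renT-as-sub there (subT θ t))))))

  subV-extS-wk : {Γ Δ : Ctx S} {τ : Sort S} (θ : Sub Γ Δ) (σ : Sort S) (v : Val Γ σ) →
                 subV (extS {τ = τ} θ) σ (renV there σ v) ≡ renV there σ (subV θ σ v)
  subV-extS-wk θ num     t = subT-extS-wk θ t
  subV-extS-wk θ (set s) x = refl

  extS-cong : {Γ Δ : Ctx S} {τ : Sort S} {θ θ' : Sub Γ Δ} → θ ≗ₛ θ' → extS {τ = τ} θ ≗ₛ extS θ'
  extS-cong e here              = refl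
  extS-cong e (there {σ = σ} x) = cong (renV there σ) (e x)

  extS-id : {Γ : Ctx S} {τ : Sort S} {θ : Sub Γ Γ} → θ ≗ₛ idₛ → extS {τ = τ} θ ≗ₛ idₛ
  extS-id e here              = refl
  extS-id e (there {σ = σ} x) = trans (cong (renV there σ) (e x)) (renV-varV there σ x)

  extS-ren⇒sub : {Γ Δ : Ctx S} {τ : Sort S} (ρ : Ren Γ Δ) →
                 extS {τ = τ} (ren⇒sub ρ) ≗ₛ ren⇒sub (ext ρ)
  extS-ren⇒sub ρ here              = refl
  extS-ren⇒sub ρ (there {σ = σ} x) = renV-varV there σ (ρ x)

  extS-∘ : {Γ Δ Ξ : Ctx S} {τ : Sort S} (θ : Sub Δ Ξ) (θ' : Sub Γ Δ) →
           extS {τ = τ} θ ∘ₛ extS θ' ≗ₛ extS (θ ∘ₛ θ')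
  extS-∘ {τ = τ} θ θ' here  = subV-varV (extS θ) τ here
  extS-∘ θ θ' (there {σ = σ} x) = subV-extS-wk θ σ (θ' x)

  subF-cong : {Γ Δ : Ctx S} {θ θ' : Sub Γ Δ} → θ ≗ₛ θ' → (φ : Fm Γ) → subF θ φ ≡ subF θ' φ
  subF-cong e (t ≐ u)   = cong₂ _≐_ (subT-cong e t) (subT-cong e u)
  subF-cong e (t ∈ₛ x)  = cong₂ _∈ₛ_ (subT-cong e t) (e x)
  subF-cong e ⊥'        = refl
  subF-cong e (φ ⇒ ψ)   = cong₂ _⇒_ (subF-cong e φ) (subF-cong e ψ)
  subF-cong e (φ ∧' ψ)  = cong₂ _∧'_ (subF-cong e φ) (subF-cong e ψ)
  subF-cong e (φ ∨' ψ)  = cong₂ _∨'_ (subF-cong e φ) (subF-cong e ψ)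
  subF-cong e (All σ φ) = cong (All σ) (subF-cong (extS-cong e) φ)
  subF-cong e (Ex σ φ)  = cong (Ex σ) (subF-cong (extS-cong e) φ)

  subF-id : {Γ : Ctx S} {θ : Sub Γ Γ} → θ ≗ₛ idₛ → (φ : Fm Γ) → subF θ φ ≡ φ
  subF-id e (t ≐ u)   = cong₂ _≐_ (subT-id e t) (subT-id e u)
  subF-id e (t ∈ₛ x)  = cong₂ _∈ₛ_ (subT-id e t) (e x)
  subF-id e ⊥'        = refl
  subF-id e (φ ⇒ ψ)   = cong₂ _⇒_ (subF-id e φ) (subF-id e ψ)
  subF-id e (φ ∧' ψ)  = cong₂ _∧'_ (subF-id e φ) (subF-id e ψ)
  subF-id e (φ ∨' ψ)  = cong₂ _∨'_ (subF-id e φ) (subF-id e ψ)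
  subF-id e (All σ φ) = cong (All σ) (subF-id (extS-id e) φ)
  subF-id e (Ex σ φ)  = cong (Ex σ) (subF-id (extS-id e) φ)

  subF-∘ : {Γ Δ Ξ : Ctx S} (θ : Sub Δ Ξ) (θ' : Sub Γ Δ) (φ : Fm Γ) →
           subF θ (subF θ' φ) ≡ subF (θ ∘ₛ θ') φ
  subF-∘ θ θ' (t ≐ u)   = cong₂ _≐_ (subT-∘ θ θ' t) (subT-∘ θ θ' u)
  subF-∘ θ θ' (t ∈ₛ x)  = cong (_∈ₛ θ (θ' x)) (subT-∘ θ θ' t)
  subF-∘ θ θ' ⊥'        = refl
  subF-∘ θ θ' (φ ⇒ ψ)   = cong₂ _⇒_ (subF-∘ θ θ' φ) (subF-∘ θ θ' ψ)
  subF-∘ θ θ' (φ ∧' ψ)  = cong₂ _∧'_ (subF-∘ θ θ' φ) (subF-∘ θ θ' ψ)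
  subF-∘ θ θ' (φ ∨' ψ)  = cong₂ _∨'_ (subF-∘ θ θ' φ) (subF-∘ θ θ' ψ)
  subF-∘ θ θ' (All σ φ) =
    cong (All σ) (trans (subF-∘ (extS θ) (extS θ') φ) (subF-cong (extS-∘ θ θ') φ))
  subF-∘ θ θ' (Ex σ φ)  =
    cong (Ex σ) (trans (subF-∘ (extS θ) (extS θ') φ) (subF-cong (extS-∘ θ θ') φ))

  renF-as-sub : {Γ Δ : Ctx S} (ρ : Ren Γ Δ) (φ : Fm Γ) → renF ρ φ ≡ subF (ren⇒sub ρ) φ
  renF-as-sub ρ (t ≐ u)   = cong₂ _≐_ (renT-as-sub ρ t) (renT-as-sub ρ u)
  renF-as-sub ρ (t ∈ₛ x)  = cong (_∈ₛ ρ x) (renT-as-sub ρ t)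
  renF-as-sub ρ ⊥'        = refl
  renF-as-sub ρ (φ ⇒ ψ)   = cong₂ _⇒_ (renF-as-sub ρ φ) (renF-as-sub ρ ψ)
  renF-as-sub ρ (φ ∧' ψ)  = cong₂ _∧'_ (renF-as-sub ρ φ) (renF-as-sub ρ ψ)
  renF-as-sub ρ (φ ∨' ψ)  = cong₂ _∨'_ (renF-as-sub ρ φ) (renF-as-sub ρ ψ)
  renF-as-sub ρ (All σ φ) =
    cong (All σ) (trans (renF-as-sub (ext ρ) φ) (sym (subF-cong (extS-ren⇒sub ρ) φ)))
  renF-as-sub ρ (Ex σ φ)  =
    cong (Ex σ) (trans (renF-as-sub (ext ρ) φ) (sym (subF-cong (extS-ren⇒sub ρ) φ)))

  NoSetQ-subF : {Γ Δ : Ctx S} (θ : Sub Γ Δ) (φ : Fm Γ) → NoSetQ φ → NoSetQ (subF θ φ)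
  NoSetQ-subF θ (t ≐ u)         n       = tt
  NoSetQ-subF θ (t ∈ₛ x)        n       = tt
  NoSetQ-subF θ ⊥'              n       = tt
  NoSetQ-subF θ (φ ⇒ ψ)         (a , b) = NoSetQ-subF θ φ a , NoSetQ-subF θ ψ b
  NoSetQ-subF θ (φ ∧' ψ)        (a , b) = NoSetQ-subF θ φ a , NoSetQ-subF θ ψ b
  NoSetQ-subF θ (φ ∨' ψ)        (a , b) = NoSetQ-subF θ φ a , NoSetQ-subF θ ψ b
  NoSetQ-subF θ (All num φ)     n       = NoSetQ-subF (extS θ) φ n
  NoSetQ-subF θ (Ex num φ)      n       = NoSetQ-subF (extS θ) φ n

eraseVal : ∀ {Γ} (σ : Sort ℕ) → Val Γ σ → Val (eraseC Γ) (eraseS σ)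
eraseVal num     t = eraseT t
eraseVal (set s) x = eraseV x

eraseVal-varV : ∀ {Γ} (σ : Sort ℕ) (x : Γ ∋ σ) →
                eraseVal σ (varV σ x) ≡ varV (eraseS σ) (eraseV x)
eraseVal-varV num     x = refl
eraseVal-varV (set s) x = refl

ErasureOf : ∀ {Γ Δ} → Sub Γ Δ → Sub (eraseC Γ) (eraseC Δ) → Set
ErasureOf {Γ} θ θ' = ∀ {σ} (x : Γ ∋ σ) → θ' (eraseV x) ≡ eraseVal σ (θ x)

eraseT-subT : ∀ {Γ Δ} {θ : Sub Γ Δ} {θ' : Sub (eraseC Γ) (eraseC Δ)} → ErasureOf θ θ' →
              (t : Tm Γ) → eraseT (subT θ t) ≡ subT θ' (eraseT t)
eraseT-subT e (var x)  = sym (e x)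
eraseT-subT e `0       = refl
eraseT-subT e `1       = refl
eraseT-subT e (t `+ u) = cong₂ _`+_ (eraseT-subT e t) (eraseT-subT e u)
eraseT-subT e (t `* u) = cong₂ _`*_ (eraseT-subT e t) (eraseT-subT e u)

ErasureOf-ren⇒sub : ∀ {Γ Δ} {ρ : Ren Γ Δ} {ρ' : Ren (eraseC Γ) (eraseC Δ)} →
                    (∀ {σ} (x : Γ ∋ σ) → ρ' (eraseV x) ≡ eraseV (ρ x)) →
                    ErasureOf (ren⇒sub ρ) (ren⇒sub ρ')
ErasureOf-ren⇒sub {ρ = ρ} e {σ} x =
  trans (cong (varV (eraseS σ)) (e x)) (sym (eraseVal-varV σ (ρ x)))

eraseVal-wk : ∀ {Γ τ} (σ : Sort ℕ) (v : Val Γ σ) →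
              eraseVal σ (renV (there {τ = τ}) σ v) ≡ renV there (eraseS σ) (eraseVal σ v)
eraseVal-wk num     t = trans (cong eraseT (renT-as-sub there t))
  (trans (eraseT-subT (ErasureOf-ren⇒sub {ρ = there} {ρ' = there} (λ x → refl)) t)
         (sym (renT-as-sub there (eraseT t))))
eraseVal-wk (set s) x = refl

ErasureOf-extS : ∀ {Γ Δ τ} {θ : Sub Γ Δ} {θ' : Sub (eraseC Γ) (eraseC Δ)} →
                 ErasureOf θ θ' → ErasureOf (extS {τ = τ} θ) (extS θ')
ErasureOf-extS {τ = τ} e here = sym (eraseVal-varV τ here)
ErasureOf-extS {θ = θ} e (there {σ = σ} x) =
  trans (cong (renV there (eraseS σ)) (e x)) (sym (eraseVal-wk σ (θ x)))

erase-subF : ∀ {Γ Δ} {θ : Sub Γ Δ} {θ' : Sub (eraseC Γ) (eraseC Δ)} → ErasureOf θ θ' →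
             (φ : Fm Γ) → subF θ φ ^ ≡ subF θ' (φ ^)
erase-subF e (t ≐ u)   = cong₂ _≐_ (eraseT-subT e t) (eraseT-subT e u)
erase-subF e (t ∈ₛ x)  = cong₂ _∈ₛ_ (eraseT-subT e t) (sym (e x))
erase-subF e ⊥'        = refl
erase-subF e (φ ⇒ ψ)   = cong₂ _⇒_ (erase-subF e φ) (erase-subF e ψ)
erase-subF e (φ ∧' ψ)  = cong₂ _∧'_ (erase-subF e φ) (erase-subF e ψ)
erase-subF e (φ ∨' ψ)  = cong₂ _∨'_ (erase-subF e φ) (erase-subF e ψ)
erase-subF e (All σ φ) = cong (All (eraseS σ)) (erase-subF (ErasureOf-extS e) φ)
erase-subF e (Ex σ φ)  = cong (Ex (eraseS σ)) (erase-subF (ErasureOf-extS e) φ)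

erase-renF : ∀ {Γ Δ} {ρ : Ren Γ Δ} {ρ' : Ren (eraseC Γ) (eraseC Δ)} →
             (∀ {σ} (x : Γ ∋ σ) → ρ' (eraseV x) ≡ eraseV (ρ x)) →
             (φ : Fm Γ) → renF ρ φ ^ ≡ renF ρ' (φ ^)
erase-renF {ρ = ρ} {ρ'} e φ = trans (cong _^ (renF-as-sub ρ φ))
  (trans (erase-subF (ErasureOf-ren⇒sub {ρ = ρ} {ρ'} e) φ) (sym (renF-as-sub ρ' (φ ^))))

erase-wk : ∀ {Γ τ} (φ : Fm Γ) → wk {τ = τ} φ ^ ≡ wk (φ ^)
erase-wk = erase-renF {ρ = there} {ρ' = there} (λ x → refl)

erase-map-wk : ∀ {Γ τ} (Δ : List (Fm Γ)) → map _^ (map (wk {τ = τ}) Δ) ≡ map wk (map _^ Δ)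
erase-map-wk []      = refl
erase-map-wk (φ ∷ Δ) = cong₂ _∷_ (erase-wk φ) (erase-map-wk Δ)

erase-[] : ∀ {Γ σ} (φ : Fm (σ ∷ Γ)) (v : Val Γ σ) → φ [ v ] ^ ≡ (φ ^) [ eraseVal σ v ]
erase-[] φ v = erase-subF (λ { here → refl ; (there {σ = σ} x) → sym (eraseVal-varV σ x) }) φ

NoSetQ-erase : ∀ {Γ} (φ : Fm Γ) → NoSetQ φ → NoSetQ (φ ^)
NoSetQ-erase (t ≐ u)     n       = tt
NoSetQ-erase (t ∈ₛ x)    n       = tt
NoSetQ-erase ⊥'          n       = tt
NoSetQ-erase (φ ⇒ ψ)     (a , b) = NoSetQ-erase φ a , NoSetQ-erase ψ b
NoSetQ-erase (φ ∧' ψ)    (a , b) = NoSetQ-erase φ a , NoSetQ-erase ψ b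
NoSetQ-erase (φ ∨' ψ)    (a , b) = NoSetQ-erase φ a , NoSetQ-erase ψ b
NoSetQ-erase (All num φ) n       = NoSetQ-erase φ n
NoSetQ-erase (Ex num φ)  n       = NoSetQ-erase φ n

erase-Ind : ∀ {Γ} (φ : Fm (num ∷ Γ)) → Ind φ ^ ≡ Ind (φ ^)
erase-Ind φ = cong₂ (λ A C → (A ∧' All num ((φ ^) ⇒ C)) ⇒ All num (φ ^))
  (erase-[] φ `0)
  (erase-subF (λ { here → refl ; (there {σ = σ} x) → sym (eraseVal-varV σ (there x)) }) φ)

erase-Comp : ∀ {Γ} (k : ℕ) (φ : Fm (num ∷ Γ)) → Comp k φ ^ ≡ Comp tt (φ ^)
erase-Comp k φ = cong (λ C → Ex (set tt) (All num ((var v0 ∈ₛ v1) ⇔ C)))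
  (erase-renF (λ { here → refl ; (there x) → refl }) φ)

erase-Choice : ∀ {Γ} (k k' : ℕ) (φ : Fm (set k ∷ num ∷ Γ)) →
               Choice k k' φ ^ ≡ Choice tt tt (φ ^)
erase-Choice {Γ} k k' φ = cong₂ shape
  (erase-renF (λ { here → refl ; (there x) → refl }) φ)
  (erase-renF (λ { here → refl ; (there here) → refl ; (there (there x)) → refl }) φ)
  where
  shape : Fm (set tt ∷ set tt ∷ num ∷ eraseC Γ) → Fm (set tt ∷ num ∷ set tt ∷ eraseC Γ) →
           Fm (eraseC Γ)
  shape A B =
    All num (Ex (set tt) ((φ ^) ∧' All (set tt) (A ⇒ setEq v1 v0))) ⇒
    Ex (set tt) (All num (Ex (set tt)
      (B ∧' All num ((var v0 ∈ₛ v1) ⇔ pair∈ (var (there (there here))) (var v0)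
                                            (there (there (there here)))))))

SA⇒Ar+AC! : ∀ {Γ φ} → SA Γ φ → (Ar +ₜ AC!) (eraseC Γ) (φ ^)
SA⇒Ar+AC! p1 = inj₁ p1
SA⇒Ar+AC! p2 = inj₁ p2
SA⇒Ar+AC! p3 = inj₁ p3
SA⇒Ar+AC! p4 = inj₁ p4
SA⇒Ar+AC! p5 = inj₁ p5
SA⇒Ar+AC! p6 = inj₁ p6
SA⇒Ar+AC! {Γ} (ind φ) =
  subst ((Ar +ₜ AC!) (eraseC Γ)) (sym (erase-Ind φ)) (inj₁ (ind (φ ^)))
SA⇒Ar+AC! {Γ} (comp k φ (n , _)) =
  subst ((Ar +ₜ AC!) (eraseC Γ)) (sym (erase-Comp k φ)) (inj₁ (comp (φ ^) (NoSetQ-erase φ n)))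
SA⇒Ar+AC! {Γ} (choice k φ (n , _)) =
  subst ((Ar +ₜ AC!) (eraseC Γ)) (sym (erase-Choice k (suc k) φ)) (inj₂ (ac (φ ^) (NoSetQ-erase φ n)))

module _ {T : Theory ℕ} {U : Theory ⊤} (erase-axiom : ∀ {Γ φ} → T Γ φ → U (eraseC Γ) (φ ^)) where

  erase-Pf : ∀ {Γ Δ φ} → Pf T Γ Δ φ → Pf U (eraseC Γ) (map _^ Δ) (φ ^)
  erase-Pf (ax a)     = ax (erase-axiom a)
  erase-Pf (hyp m)    = hyp (∈-map⁺ _^ m)
  erase-Pf (⇒I p)     = ⇒I (erase-Pf p)
  erase-Pf (⇒E p q)   = ⇒E (erase-Pf p) (erase-Pf q)
  erase-Pf (∧I p q)   = ∧I (erase-Pf p) (erase-Pf q)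
  erase-Pf (∧E₁ p)    = ∧E₁ (erase-Pf p)
  erase-Pf (∧E₂ p)    = ∧E₂ (erase-Pf p)
  erase-Pf (∨I₁ p)    = ∨I₁ (erase-Pf p)
  erase-Pf (∨I₂ p)    = ∨I₂ (erase-Pf p)
  erase-Pf (∨E p q r) = ∨E (erase-Pf p) (erase-Pf q) (erase-Pf r)
  erase-Pf (raa p)    = raa (erase-Pf p)
  erase-Pf {Γ} {Δ} (∀I {σ = σ} {φ = φ} p) =
    ∀I (subst (λ Δ' → Pf U (eraseS σ ∷ eraseC Γ) Δ' (φ ^)) (erase-map-wk Δ) (erase-Pf p))
  erase-Pf {Γ} {Δ} (∀E {σ = σ} {φ = φ} p v) =
    subst (Pf U (eraseC Γ) (map _^ Δ)) (sym (erase-[] φ v)) (∀E (erase-Pf p) (eraseVal σ v))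
  erase-Pf {Γ} {Δ} (∃I {σ = σ} {φ = φ} v p) =
    ∃I (eraseVal σ v) (subst (Pf U (eraseC Γ) (map _^ Δ)) (erase-[] φ v) (erase-Pf p))
  erase-Pf {Γ} {Δ} (∃E {σ = σ} {φ = φ} {χ = χ} p q) =
    ∃E (erase-Pf p) (subst₂ (λ Δ' χ' → Pf U (eraseS σ ∷ eraseC Γ) ((φ ^) ∷ Δ') χ')
                            (erase-map-wk Δ) (erase-wk χ) (erase-Pf q))
  erase-Pf (=refl t)  = =refl (eraseT t)
  erase-Pf {Γ} {Δ} (=subst {t = t} {u = u} φ p q) =
    subst (Pf U (eraseC Γ) (map _^ Δ)) (sym (erase-[] φ u))
          (=subst (φ ^) (erase-Pf p) (subst (Pf U (eraseC Γ) (map _^ Δ)) (erase-[] φ t) (erase-Pf q)))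

close-erase : ∀ {U : Theory ⊤} (Γ : Ctx ℕ) (φ : Fm Γ) →
              Pf U (eraseC Γ) [] (φ ^) → U ⊢ (close Γ φ ^)
close-erase []      φ p = p
close-erase (σ ∷ Γ) φ p = close-erase Γ (All σ φ) (∀I p)

private variable
  S : Set
  Γ : Ctx S
  Δ : List (Fm Γ)

∈₀ : ∀ {A : Set} {x : A} {xs} → x ∈ x ∷ xs
∈₀ = Any.here refl

∈₁ : ∀ {A : Set} {x y : A} {xs} → x ∈ y ∷ x ∷ xs
∈₁ = Any.there ∈₀

∈₂ : ∀ {A : Set} {x y z : A} {xs} → x ∈ z ∷ y ∷ x ∷ xs
∈₂ = Any.there ∈₁

_⊆ₜ_ : ∀ {S} → Theory S → Theory S → Set
T ⊆ₜ U = ∀ {Γ φ} → T Γ φ → U Γ φ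

module _ {S : Set} where
  x0 : {Γ : Ctx S} → Tm (num ∷ Γ)
  x0 = var here
  x1 : {Γ : Ctx S} {a : Sort S} → Tm (a ∷ num ∷ Γ)
  x1 = var (there here)
  x2 : {Γ : Ctx S} {a b : Sort S} → Tm (a ∷ b ∷ num ∷ Γ)
  x2 = var (there (there here))
  x3 : {Γ : Ctx S} {a b c : Sort S} → Tm (a ∷ b ∷ c ∷ num ∷ Γ)
  x3 = var (there (there (there here)))
  x4 : {Γ : Ctx S} {a b c d : Sort S} → Tm (a ∷ b ∷ c ∷ d ∷ num ∷ Γ)
  x4 = var (there (there (there (there here))))
  x5 : {Γ : Ctx S} {a b c d e : Sort S} → Tm (a ∷ b ∷ c ∷ d ∷ e ∷ num ∷ Γ)
  x5 = var (there (there (there (there (there here)))))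

  nums : ℕ → Ctx S → Ctx S
  nums zero    Γ = Γ
  nums (suc n) Γ = num ∷ nums n Γ

  Alls : ∀ {Γ} n → Fm (nums n Γ) → Fm Γ
  Alls zero    φ = φ
  Alls (suc n) φ = Alls n (All num φ)

  subVec : ∀ {Γ n} → Vec (Tm Γ) n → Sub (nums n Γ) Γ
  subVec []       x         = idₛ x
  subVec (t ∷ ts) here      = t
  subVec (t ∷ ts) (there x) = subVec ts x

  ∈-wk : ∀ {Γ : Ctx S} {σ} {Δ : List (Fm Γ)} {φ : Fm Γ} {φ' : Fm (σ ∷ Γ)} →
         φ ∈ Δ → φ' ≡ wk φ → φ' ∈ map wk Δ
  ∈-wk i refl = ∈-map⁺ wk i

  wk² : ∀ {Γ : Ctx S} {σ τ} → Tm Γ → Tm (σ ∷ τ ∷ Γ)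
  wk² t = renT there (renT there t)

  subT-extS²-wk : ∀ {Γ Δ : Ctx S} {σ τ} (θ : Sub Γ Δ) (t : Tm Γ) →
                  subT (extS {τ = σ} (extS {τ = τ} θ)) (wk² t) ≡ wk² (subT θ t)
  subT-extS²-wk θ t = trans (subT-extS-wk (extS θ) (renT there t)) (cong (renT there) (subT-extS-wk θ t))

  pair∈-subF : ∀ {Γ Δ : Ctx S} {s} (θ : Sub Γ Δ) (t u : Tm Γ) (y : Γ ∋ set s) →
               subF θ (pair∈ t u y) ≡ pair∈ (subT θ t) (subT θ u) (θ y)
  pair∈-subF θ t u y =
    cong₂ (λ a b → Ex num ((var v0 `+ var v0 ≐ (a `+ b) `* (a `+ b `+ `1) `+ b `+ b)
                           ∧' (var v0 ∈ₛ there (θ y))))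
          (subT-extS-wk θ t) (subT-extS-wk θ u)

  pair∈-wk : ∀ {Γ : Ctx S} {s τ} (t u : Tm Γ) (y : Γ ∋ set s) →
             wk {τ = τ} (pair∈ t u y) ≡ pair∈ (renT there t) (renT there u) (there y)
  pair∈-wk t u y = trans (renF-as-sub there (pair∈ t u y))
    (trans (pair∈-subF (ren⇒sub there) t u y)
           (cong₂ (λ a b → pair∈ a b (there y)) (sym (renT-as-sub there t)) (sym (renT-as-sub there u))))

module Logic {S : Set} (T : Theory S) where

  hyp₀ : ∀ {φ : Fm Γ} → Pf T Γ (φ ∷ Δ) φ
  hyp₀ = hyp ∈₀
  hyp₁ : ∀ {φ ψ : Fm Γ} → Pf T Γ (ψ ∷ φ ∷ Δ) φ
  hyp₁ = hyp ∈₁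
  hyp₂ : ∀ {φ ψ χ : Fm Γ} → Pf T Γ (χ ∷ ψ ∷ φ ∷ Δ) φ
  hyp₂ = hyp ∈₂
  hyp₃ : ∀ {φ ψ χ ξ : Fm Γ} → Pf T Γ (ξ ∷ χ ∷ ψ ∷ φ ∷ Δ) φ
  hyp₃ = hyp (Any.there ∈₂)

  ⊥'-elim : ∀ {φ : Fm Γ} → Pf T Γ Δ ⊥' → Pf T Γ Δ φ
  ⊥'-elim p = ⇒E (⇒I (raa hyp₁)) p

  have : ∀ {φ ψ : Fm Γ} → Pf T Γ Δ φ → Pf T Γ (φ ∷ Δ) ψ → Pf T Γ Δ ψ
  have p q = ⇒E (⇒I q) p

  ∃E-≡ : ∀ {σ} {φ : Fm (σ ∷ Γ)} {χ : Fm Γ} {χ' : Fm (σ ∷ Γ)} →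
         Pf T Γ Δ (Ex σ φ) → χ' ≡ wk χ → Pf T (σ ∷ Γ) (φ ∷ map wk Δ) χ' → Pf T Γ Δ χ
  ∃E-≡ p refl q = ∃E p q

  -- Lemmas are proved as closed universal statements about variables, where
  -- substitution computes, and then instantiated with ∀E-many.
  ∀E-many : ∀ n (φ : Fm (nums n Γ)) → Pf T Γ Δ (Alls n φ) →
            (ts : Vec (Tm Γ) n) → Pf T Γ Δ (subF (subVec ts) φ)
  ∀E-many zero φ p [] = subst (Pf T _ _) (sym (subF-id (λ x → refl) φ)) p
  ∀E-many (suc n) φ p (t ∷ ts) =
    subst (Pf T _ _) (trans (subF-∘ (sub0 t) (extS (subVec ts)) φ) (subF-cong pointwise φ))
          (∀E (∀E-many n (All num φ) p ts) t)
    where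
    pointwise : sub0 t ∘ₛ extS (subVec ts) ≗ₛ subVec (t ∷ ts)
    pointwise here              = refl
    pointwise (there {σ = σ} x) = subV-sub0-wk t σ (subVec ts x)

  ≐-sym : ∀ {a b : Tm Γ} → Pf T Γ Δ (a ≐ b) → Pf T Γ Δ (b ≐ a)
  ≐-sym {a = a} {b} p = ⇒E (∀E-many 2 _ closed (b ∷ a ∷ [])) p
    where
    closed : Pf T Γ Δ (All num (All num ((x1 ≐ x0) ⇒ (x0 ≐ x1))))
    closed = ∀I (∀I (⇒I (=subst (x0 ≐ x2) hyp₀ (=refl x1))))

  ≐-trans : ∀ {a b c : Tm Γ} → Pf T Γ Δ (a ≐ b) → Pf T Γ Δ (b ≐ c) → Pf T Γ Δ (a ≐ c)
  ≐-trans {a = a} {b} {c} p q = ⇒E (⇒E (∀E-many 3 _ closed (c ∷ b ∷ a ∷ [])) p) q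
    where
    closed : Pf T Γ Δ (All num (All num (All num ((x2 ≐ x1) ⇒ (x1 ≐ x0) ⇒ (x2 ≐ x0)))))
    closed = ∀I (∀I (∀I (⇒I (⇒I (=subst (x3 ≐ x0) hyp₀ hyp₁)))))

  +-cong : ∀ {a b c d : Tm Γ} → Pf T Γ Δ (a ≐ b) → Pf T Γ Δ (c ≐ d) →
           Pf T Γ Δ (a `+ c ≐ b `+ d)
  +-cong {a = a} {b} {c} {d} p q = ⇒E (⇒E (∀E-many 4 _ closed (d ∷ c ∷ b ∷ a ∷ [])) p) q
    where
    closed : Pf T Γ Δ (All num (All num (All num (All num
               ((x3 ≐ x2) ⇒ (x1 ≐ x0) ⇒ (x3 `+ x1 ≐ x2 `+ x0))))))
    closed = ∀I (∀I (∀I (∀I (⇒I (⇒I (=subst (x4 `+ x2 ≐ x3 `+ x0) hyp₀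
               (=subst (x4 `+ x2 ≐ x0 `+ x2) hyp₁ (=refl (x3 `+ x1)))))))))

  *-cong : ∀ {a b c d : Tm Γ} → Pf T Γ Δ (a ≐ b) → Pf T Γ Δ (c ≐ d) →
           Pf T Γ Δ (a `* c ≐ b `* d)
  *-cong {a = a} {b} {c} {d} p q = ⇒E (⇒E (∀E-many 4 _ closed (d ∷ c ∷ b ∷ a ∷ [])) p) q
    where
    closed : Pf T Γ Δ (All num (All num (All num (All num
               ((x3 ≐ x2) ⇒ (x1 ≐ x0) ⇒ (x3 `* x1 ≐ x2 `* x0))))))
    closed = ∀I (∀I (∀I (∀I (⇒I (⇒I (=subst (x4 `* x2 ≐ x3 `* x0) hyp₀
               (=subst (x4 `* x2 ≐ x0 `* x2) hyp₁ (=refl (x3 `* x1)))))))))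

  +-congˡ : ∀ {a b : Tm Γ} (c : Tm Γ) → Pf T Γ Δ (a ≐ b) → Pf T Γ Δ (c `+ a ≐ c `+ b)
  +-congˡ c p = +-cong (=refl c) p

  +-congʳ : ∀ {a b : Tm Γ} (c : Tm Γ) → Pf T Γ Δ (a ≐ b) → Pf T Γ Δ (a `+ c ≐ b `+ c)
  +-congʳ c p = +-cong p (=refl c)

  suc-cong : ∀ {a b : Tm Γ} → Pf T Γ Δ (a ≐ b) → Pf T Γ Δ (a `+ `1 ≐ b `+ `1)
  suc-cong = +-congʳ `1

  ∈-cong : ∀ {s} {a b : Tm Γ} {x : Γ ∋ set s} →
           Pf T Γ Δ (a ≐ b) → Pf T Γ Δ (a ∈ₛ x) → Pf T Γ Δ (b ∈ₛ x)
  ∈-cong {x = x} e p = =subst (x0 ∈ₛ there x) e p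

IndStep : ∀ {S} {Γ : Ctx S} → Fm Γ → Fm (num ∷ Γ)
IndStep ((_ ∧' All num (_ ⇒ step)) ⇒ _) = step
IndStep _                               = ⊥'

pronic : Tm Γ → Tm Γ
pronic s = s `* (s `+ `1)

-- p is the code (k,m) of the Cantor pairing, stated doubled as in `pair∈`.
IsCode : Tm Γ → Tm Γ → Tm Γ → Fm Γ
IsCode p k m = p `+ p ≐ pronic (k `+ m) `+ m `+ m

infix 4 _≤ᵗ_ _<ᵗ_
_≤ᵗ_ : Tm Γ → Tm Γ → Fm Γ
a ≤ᵗ b = Ex num (renT there a `+ x0 ≐ renT there b)

_<ᵗ_ : Tm Γ → Tm Γ → Fm Γ
a <ᵗ b = a `+ `1 ≤ᵗ b

module Arithmetic {T : Theory ⊤} (ar : Ar ⊆ₜ T) where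
  open Logic T

  -- `Ind` builds φ(n+1) with a substitution local to Defs; `IndStep` recovers it.
  induction : (φ : Fm (num ∷ Γ)) → Pf T Γ Δ (φ [ `0 ]) →
              Pf T (num ∷ Γ) (φ ∷ map wk Δ) (IndStep (Ind φ)) → Pf T Γ Δ (All num φ)
  induction φ base step = ⇒E (ax (ar (ind φ))) (∧I base (∀I (⇒I step)))

  suc≢0 : (a : Tm Γ) → Pf T Γ Δ (a `+ `1 ≐ `0 ⇒ ⊥')
  suc≢0 a = ∀E-many 1 _ (ax (ar p1)) (a ∷ [])

  suc-injective : ∀ {a b : Tm Γ} → Pf T Γ Δ (a `+ `1 ≐ b `+ `1) → Pf T Γ Δ (a ≐ b)
  suc-injective {a = a} {b} p = ⇒E (∀E-many 2 _ (ax (ar p2)) (b ∷ a ∷ [])) p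

  +-identityʳ : (a : Tm Γ) → Pf T Γ Δ (a `+ `0 ≐ a)
  +-identityʳ a = ∀E-many 1 _ (ax (ar p3)) (a ∷ [])

  +-suc : (a b : Tm Γ) → Pf T Γ Δ (a `+ (b `+ `1) ≐ (a `+ b) `+ `1)
  +-suc a b = ∀E-many 2 _ (ax (ar p4)) (b ∷ a ∷ [])

  *-zeroʳ : (a : Tm Γ) → Pf T Γ Δ (a `* `0 ≐ `0)
  *-zeroʳ a = ∀E-many 1 _ (ax (ar p5)) (a ∷ [])

  *-suc : (a b : Tm Γ) → Pf T Γ Δ (a `* (b `+ `1) ≐ a `* b `+ a)
  *-suc a b = ∀E-many 2 _ (ax (ar p6)) (b ∷ a ∷ [])

  +-identityˡ : (a : Tm Γ) → Pf T Γ Δ (`0 `+ a ≐ a)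
  +-identityˡ a = ∀E-many 1 _ closed (a ∷ [])
    where
    closed : Pf T Γ Δ (All num (`0 `+ x0 ≐ x0))
    closed = induction (`0 `+ x0 ≐ x0) (+-identityʳ `0) (≐-trans (+-suc `0 x0) (suc-cong hyp₀))

  suc-+ : (a b : Tm Γ) → Pf T Γ Δ ((a `+ `1) `+ b ≐ (a `+ b) `+ `1)
  suc-+ a b = ∀E-many 2 _ closed (b ∷ a ∷ [])
    where
    closed : Pf T Γ Δ (All num (All num ((x1 `+ `1) `+ x0 ≐ (x1 `+ x0) `+ `1)))
    closed = ∀I (induction ((x1 `+ `1) `+ x0 ≐ (x1 `+ x0) `+ `1)
      (≐-trans (+-identityʳ (x0 `+ `1)) (≐-sym (suc-cong (+-identityʳ x0))))
      (≐-trans (+-suc (x1 `+ `1) x0) (≐-trans (suc-cong hyp₀) (suc-cong (≐-sym (+-suc x1 x0))))))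

  +-comm : (a b : Tm Γ) → Pf T Γ Δ (a `+ b ≐ b `+ a)
  +-comm a b = ∀E-many 2 _ closed (b ∷ a ∷ [])
    where
    closed : Pf T Γ Δ (All num (All num (x1 `+ x0 ≐ x0 `+ x1)))
    closed = ∀I (induction (x1 `+ x0 ≐ x0 `+ x1)
      (≐-trans (+-identityʳ x0) (≐-sym (+-identityˡ x0)))
      (≐-trans (+-suc x1 x0) (≐-trans (suc-cong hyp₀) (≐-sym (suc-+ x0 x1)))))

  +-assoc : (a b c : Tm Γ) → Pf T Γ Δ ((a `+ b) `+ c ≐ a `+ (b `+ c))
  +-assoc a b c = ∀E-many 3 _ closed (c ∷ b ∷ a ∷ [])
    where
    closed : Pf T Γ Δ (All num (All num (All num ((x2 `+ x1) `+ x0 ≐ x2 `+ (x1 `+ x0)))))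
    closed = ∀I (∀I (induction ((x2 `+ x1) `+ x0 ≐ x2 `+ (x1 `+ x0))
      (≐-trans (+-identityʳ (x1 `+ x0)) (+-congˡ x1 (≐-sym (+-identityʳ x0))))
      (≐-trans (+-suc (x2 `+ x1) x0) (≐-trans (suc-cong hyp₀)
        (≐-trans (≐-sym (+-suc x2 (x1 `+ x0))) (+-congˡ x2 (≐-sym (+-suc x1 x0))))))))

  +-cancelʳ : ∀ {a b c : Tm Γ} → Pf T Γ Δ (a `+ c ≐ b `+ c) → Pf T Γ Δ (a ≐ b)
  +-cancelʳ {a = a} {b} {c} p = ⇒E (∀E-many 3 _ closed (c ∷ b ∷ a ∷ [])) p
    where
    closed : Pf T Γ Δ (All num (All num (All num ((x2 `+ x0 ≐ x1 `+ x0) ⇒ (x2 ≐ x1)))))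
    closed = ∀I (∀I (induction ((x2 `+ x0 ≐ x1 `+ x0) ⇒ (x2 ≐ x1))
      (⇒I (≐-trans (≐-sym (+-identityʳ x1)) (≐-trans hyp₀ (+-identityʳ x0))))
      (⇒I (⇒E hyp₁ (suc-injective (≐-trans (≐-sym (+-suc x2 x0)) (≐-trans hyp₀ (+-suc x1 x0))))))))

  +-cancelˡ : ∀ {a b c : Tm Γ} → Pf T Γ Δ (c `+ a ≐ c `+ b) → Pf T Γ Δ (a ≐ b)
  +-cancelˡ {a = a} {b} {c} p = +-cancelʳ (≐-trans (+-comm a c) (≐-trans p (+-comm c b)))

  +-interchange : (a b c d : Tm Γ) → Pf T Γ Δ ((a `+ b) `+ (c `+ d) ≐ (a `+ c) `+ (b `+ d))
  +-interchange a b c d = ≐-trans (+-assoc a b (c `+ d))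
    (≐-trans (+-congˡ a (≐-trans (≐-sym (+-assoc b c d))
                        (≐-trans (+-congʳ d (+-comm b c)) (+-assoc c b d))))
             (≐-sym (+-assoc a c (b `+ d))))

  double-+ : (a b : Tm Γ) → Pf T Γ Δ ((a `+ b) `+ (a `+ b) ≐ ((a `+ a) `+ b) `+ b)
  double-+ a b = ≐-trans (+-interchange a b a b) (≐-sym (+-assoc (a `+ a) b b))

  suc-* : (a b : Tm Γ) → Pf T Γ Δ ((a `+ `1) `* b ≐ a `* b `+ b)
  suc-* a b = ∀E-many 2 _ closed (b ∷ a ∷ [])
    where
    swap : ∀ {Ξ} {Θ : List (Fm Ξ)} (m a b : Tm Ξ) →
           Pf T Ξ Θ ((m `+ b) `+ (a `+ `1) ≐ (m `+ a) `+ (b `+ `1))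
    swap m a b = ≐-trans (+-assoc m b (a `+ `1))
      (≐-trans (+-congˡ m (≐-trans (+-suc b a) (≐-trans (suc-cong (+-comm b a)) (≐-sym (+-suc a b)))))
               (≐-sym (+-assoc m a (b `+ `1))))
    closed : Pf T Γ Δ (All num (All num ((x1 `+ `1) `* x0 ≐ x1 `* x0 `+ x0)))
    closed = ∀I (induction ((x1 `+ `1) `* x0 ≐ x1 `* x0 `+ x0)
      (≐-trans (*-zeroʳ (x0 `+ `1)) (≐-sym (≐-trans (+-identityʳ (x0 `* `0)) (*-zeroʳ x0))))
      (≐-trans (*-suc (x1 `+ `1) x0) (≐-trans (+-congʳ (x1 `+ `1) hyp₀)
        (≐-trans (swap (x1 `* x0) x1 x0) (+-congʳ (x0 `+ `1) (≐-sym (*-suc x1 x0)))))))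

  pronic-cong : ∀ {a b : Tm Γ} → Pf T Γ Δ (a ≐ b) → Pf T Γ Δ (pronic a ≐ pronic b)
  pronic-cong p = *-cong p (suc-cong p)

  pronic-suc : (s : Tm Γ) → Pf T Γ Δ (pronic (s `+ `1) ≐ (pronic s `+ (s `+ `1)) `+ (s `+ `1))
  pronic-suc s = ≐-trans (*-suc (s `+ `1) (s `+ `1)) (+-congʳ (s `+ `1)
    (≐-trans (*-suc (s `+ `1) s) (+-congʳ (s `+ `1) (≐-trans (suc-* s s) (≐-sym (*-suc s s))))))

  ≤ᵗ-intro : ∀ {a b : Tm Γ} (d : Tm Γ) → Pf T Γ Δ (a `+ d ≐ b) → Pf T Γ Δ (a ≤ᵗ b)
  ≤ᵗ-intro {a = a} {b} d p =
    ∃I d (subst (Pf T _ _) (sym (cong₂ (λ u v → u `+ d ≐ v) (subT-sub0-wk d a) (subT-sub0-wk d b))) p)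

  ≤ᵗ-refl : (a : Tm Γ) → Pf T Γ Δ (a ≤ᵗ a)
  ≤ᵗ-refl a = ≤ᵗ-intro `0 (+-identityʳ a)

  ≤ᵗ-reflexive : ∀ {a b : Tm Γ} → Pf T Γ Δ (a ≐ b) → Pf T Γ Δ (a ≤ᵗ b)
  ≤ᵗ-reflexive {a = a} p = ≤ᵗ-intro `0 (≐-trans (+-identityʳ a) p)

  m≤ᵗm+n : (a b : Tm Γ) → Pf T Γ Δ (a ≤ᵗ a `+ b)
  m≤ᵗm+n a b = ≤ᵗ-intro b (=refl _)

  ≤ᵗ-trans : ∀ {a b c : Tm Γ} → Pf T Γ Δ (a ≤ᵗ b) → Pf T Γ Δ (b ≤ᵗ c) → Pf T Γ Δ (a ≤ᵗ c)
  ≤ᵗ-trans {a = a} {b} {c} p q = ⇒E (⇒E (∀E-many 3 _ closed (c ∷ b ∷ a ∷ [])) p) q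
    where
    closed : Pf T Γ Δ (All num (All num (All num (x2 ≤ᵗ x1 ⇒ x1 ≤ᵗ x0 ⇒ x2 ≤ᵗ x0))))
    closed = ∀I (∀I (∀I (⇒I (⇒I (∃E hyp₁ (∃E hyp₁
      (∃I (x1 `+ x0) (≐-trans (≐-sym (+-assoc x4 x1 x0)) (≐-trans (+-congʳ x0 hyp₁) hyp₀)))))))))

  +-mono-≤ᵗ : ∀ {a b c d : Tm Γ} → Pf T Γ Δ (a ≤ᵗ b) → Pf T Γ Δ (c ≤ᵗ d) →
              Pf T Γ Δ (a `+ c ≤ᵗ b `+ d)
  +-mono-≤ᵗ {a = a} {b} {c} {d} p q = ⇒E (⇒E (∀E-many 4 _ closed (d ∷ c ∷ b ∷ a ∷ [])) p) q
    where
    closed : Pf T Γ Δ (All num (All num (All num (All num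
               (x3 ≤ᵗ x2 ⇒ x1 ≤ᵗ x0 ⇒ x3 `+ x1 ≤ᵗ x2 `+ x0)))))
    closed = ∀I (∀I (∀I (∀I (⇒I (⇒I (∃E hyp₁ (∃E hyp₁
      (∃I (x1 `+ x0) (≐-trans (+-interchange x5 x3 x1 x0) (+-cong hyp₁ hyp₀))))))))))

  <ᵗ-irrefl : ∀ {a b : Tm Γ} → Pf T Γ Δ (a ≐ b) → Pf T Γ Δ (a <ᵗ b) → Pf T Γ Δ ⊥'
  <ᵗ-irrefl {a = a} e p = ⇒E (∀E-many 1 _ closed (a ∷ [])) (≤ᵗ-trans p (≤ᵗ-reflexive (≐-sym e)))
    where
    closed : Pf T Γ Δ (All num (x0 <ᵗ x0 ⇒ ⊥'))
    closed = ∀I (⇒I (∃E hyp₀ (⇒E (suc≢0 x0) (+-cancelʳ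
      (≐-trans (+-comm (x0 `+ `1) x1)
        (≐-trans (≐-trans (+-suc x1 x0) (≐-trans (≐-sym (suc-+ x1 x0)) hyp₀))
          (≐-sym (+-identityˡ x1))))))))

  zero∨suc : (a : Tm Γ) → Pf T Γ Δ ((a ≐ `0) ∨' Ex num (renT there a ≐ x0 `+ `1))
  zero∨suc a = ∀E-many 1 _ closed (a ∷ [])
    where
    closed : Pf T Γ Δ (All num ((x0 ≐ `0) ∨' Ex num (x1 ≐ x0 `+ `1)))
    closed = induction _ (∨I₁ (=refl `0)) (∨I₂ (∃I x0 (=refl (x0 `+ `1))))

  double-mono-<ᵗ : ∀ {a b : Tm Γ} → Pf T Γ Δ (a <ᵗ b) → Pf T Γ Δ (a `+ a <ᵗ b `+ b)
  double-mono-<ᵗ {a = a} p = ≤ᵗ-trans (m≤ᵗm+n _ `1)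
    (≤ᵗ-trans (≤ᵗ-reflexive (≐-sym (≐-trans (+-suc (a `+ `1) a) (suc-cong (suc-+ a a)))))
              (+-mono-≤ᵗ p p))

  <ᵗ-trichotomy : (a b : Tm Γ) → Pf T Γ Δ (a <ᵗ b ∨' (a ≐ b) ∨' b <ᵗ a)
  <ᵗ-trichotomy a b = ∀E-many 2 _ closed (b ∷ a ∷ [])
    where
    closed : Pf T Γ Δ (All num (All num (x1 <ᵗ x0 ∨' (x1 ≐ x0) ∨' x0 <ᵗ x1)))
    closed = ∀I (induction (x1 <ᵗ x0 ∨' (x1 ≐ x0) ∨' x0 <ᵗ x1)
      (∨E (zero∨suc x0) (∨I₂ (∨I₁ hyp₀))
        (∃E hyp₀ (∨I₂ (∨I₂ (∃I x0
          (≐-trans (suc-+ `0 x0) (≐-trans (suc-cong (+-identityˡ x0)) (≐-sym hyp₀))))))))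
      (∨E hyp₀ (∃E hyp₀ (∨I₁ (∃I (x0 `+ `1) (≐-trans (+-suc (x2 `+ `1) x0) (suc-cong hyp₀)))))
        (∨E hyp₀ (∨I₁ (∃I `0 (≐-trans (+-identityʳ _) (suc-cong hyp₀))))
          (∃E hyp₀ (∨E (zero∨suc x0)
            (∨I₂ (∨I₁ (≐-sym (≐-trans (≐-sym (+-identityʳ (x1 `+ `1)))
                                      (≐-trans (+-congˡ (x1 `+ `1) (≐-sym hyp₀)) hyp₁)))))
            (∃E hyp₀ (∨I₂ (∨I₂ (∃I x0 (≐-trans (suc-+ (x2 `+ `1) x0)
              (≐-trans (≐-sym (+-suc (x2 `+ `1) x0))
                       (≐-trans (+-congˡ (x2 `+ `1) (≐-sym hyp₀)) hyp₂))))))))))))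

  pronic-mono-+ : (a d : Tm Γ) → Pf T Γ Δ (pronic a ≤ᵗ pronic (a `+ d))
  pronic-mono-+ a d = ∀E-many 2 _ closed (d ∷ a ∷ [])
    where
    closed : Pf T Γ Δ (All num (All num (pronic x1 ≤ᵗ pronic (x1 `+ x0))))
    closed = ∀I (induction (pronic x1 ≤ᵗ pronic (x1 `+ x0))
      (≤ᵗ-reflexive (≐-sym (pronic-cong (+-identityʳ x0))))
      (≤ᵗ-trans hyp₀ (≤ᵗ-trans
        (≤ᵗ-trans (m≤ᵗm+n _ ((x1 `+ x0) `+ `1)) (m≤ᵗm+n _ ((x1 `+ x0) `+ `1)))
        (≤ᵗ-reflexive (≐-trans (≐-sym (pronic-suc (x1 `+ x0))) (pronic-cong (≐-sym (+-suc x1 x0))))))))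

  pronic-mono-≤ᵗ : ∀ {a b : Tm Γ} → Pf T Γ Δ (a ≤ᵗ b) → Pf T Γ Δ (pronic a ≤ᵗ pronic b)
  pronic-mono-≤ᵗ {a = a} {b} p = ⇒E (∀E-many 2 _ closed (b ∷ a ∷ [])) p
    where
    closed : Pf T Γ Δ (All num (All num (x1 ≤ᵗ x0 ⇒ pronic x1 ≤ᵗ pronic x0)))
    closed = ∀I (∀I (⇒I (∃E hyp₀ (≤ᵗ-trans (pronic-mono-+ x2 x0) (≤ᵗ-reflexive (pronic-cong hyp₀))))))

  pronic-even : (s : Tm Γ) → Pf T Γ Δ (Ex num (x0 `+ x0 ≐ pronic (renT there s)))
  pronic-even s = ∀E-many 1 _ closed (s ∷ [])
    where
    closed : Pf T Γ Δ (All num (Ex num (x0 `+ x0 ≐ pronic x1)))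
    closed = induction (Ex num (x0 `+ x0 ≐ pronic x1))
      (∃I `0 (≐-trans (+-identityʳ `0)
        (≐-sym (≐-trans (*-suc `0 `0) (≐-trans (+-identityʳ (`0 `* `0)) (*-zeroʳ `0))))))
      (∃E hyp₀ (∃I (x0 `+ (x1 `+ `1)) (≐-trans (double-+ x0 (x1 `+ `1))
        (≐-trans (+-congʳ (x1 `+ `1) (+-congʳ (x1 `+ `1) hyp₀)) (≐-sym (pronic-suc x1))))))

  code-exists : (k m : Tm Γ) → Pf T Γ Δ (Ex num (IsCode x0 (renT there k) (renT there m)))
  code-exists k m = ∀E-many 2 _ closed (m ∷ k ∷ [])
    where
    closed : Pf T Γ Δ (All num (All num (Ex num (IsCode x0 x2 x1))))
    closed = ∀I (∀I (∃E (pronic-even (x1 `+ x0))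
      (∃I (x0 `+ x1) (≐-trans (double-+ x0 x1) (+-congʳ x1 (+-congʳ x1 hyp₀))))))

  double-injective : ∀ {a b : Tm Γ} → Pf T Γ Δ (a `+ a ≐ b `+ b) → Pf T Γ Δ (a ≐ b)
  double-injective {a = a} {b} p = ⇒E (∀E-many 2 _ closed (b ∷ a ∷ [])) p
    where
    closed : Pf T Γ Δ (All num (All num ((x1 `+ x1 ≐ x0 `+ x0) ⇒ (x1 ≐ x0))))
    closed = ∀I (∀I (⇒I (∨E (<ᵗ-trichotomy x1 x0)
      (⊥'-elim (<ᵗ-irrefl hyp₁ (double-mono-<ᵗ hyp₀)))
      (∨E hyp₀ hyp₀ (⊥'-elim (<ᵗ-irrefl (≐-sym hyp₂) (double-mono-<ᵗ hyp₀)))))))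

  code-mono-diagonal : (k m s m' : Tm Γ) → Pf T Γ Δ (k `+ m <ᵗ s) →
            Pf T Γ Δ (pronic (k `+ m) `+ m `+ m <ᵗ pronic s `+ m' `+ m')
  code-mono-diagonal {Γ = Γ} {Δ = Δ} k m s m' k+m<s =
    ≤ᵗ-trans step₁ (≤ᵗ-trans (≤ᵗ-reflexive (≐-sym (+-suc _ d)))
      (≤ᵗ-trans step₂ (≤ᵗ-trans (≤ᵗ-reflexive (≐-sym (pronic-suc d)))
        (≤ᵗ-trans (pronic-mono-≤ᵗ k+m<s) step₃))))
    where
    d : Tm Γ
    d = k `+ m
    step₁ : Pf T Γ Δ (pronic d `+ m `+ m `+ `1 ≤ᵗ (pronic d `+ d) `+ d `+ `1)
    step₁ = +-mono-≤ᵗ (+-mono-≤ᵗ (+-mono-≤ᵗ (≤ᵗ-refl (pronic d)) m≤d) m≤d) (≤ᵗ-refl `1)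
      where
      m≤d : Pf T Γ Δ (m ≤ᵗ d)
      m≤d = ≤ᵗ-intro k (+-comm m k)
    step₂ : Pf T Γ Δ ((pronic d `+ d) `+ (d `+ `1) ≤ᵗ (pronic d `+ (d `+ `1)) `+ (d `+ `1))
    step₂ = +-mono-≤ᵗ (+-mono-≤ᵗ (≤ᵗ-refl _) (m≤ᵗm+n d `1)) (≤ᵗ-refl _)
    step₃ : Pf T Γ Δ (pronic s ≤ᵗ pronic s `+ m' `+ m')
    step₃ = ≤ᵗ-trans (m≤ᵗm+n _ m') (m≤ᵗm+n _ m')

  code-injective-diagonal : ∀ {p k m k' m' : Tm Γ} →
                            Pf T Γ Δ (IsCode p k m) → Pf T Γ Δ (IsCode p k' m') →
                            Pf T Γ Δ (k `+ m ≐ k' `+ m') → Pf T Γ Δ (m ≐ m')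
  code-injective-diagonal {m = m} {m' = m'} c c' e = double-injective (+-cancelˡ
    (≐-trans (≐-sym (+-assoc _ m m))
      (≐-trans (≐-trans (≐-sym c) c') (≐-trans (+-congʳ m' (+-congʳ m' (≐-sym (pronic-cong e))))
                                                (+-assoc _ m' m')))))

  -- Codes on different diagonals differ; on one diagonal m, and then k, is determined.
  code-injective : ∀ {p k m k' m' : Tm Γ} → Pf T Γ Δ (IsCode p k m) → Pf T Γ Δ (IsCode p k' m') →
                   Pf T Γ Δ ((k ≐ k') ∧' (m ≐ m'))
  code-injective {p = p} {k} {m} {k'} {m'} c c' =
    ⇒E (⇒E (∀E-many 5 _ closed (m' ∷ k' ∷ m ∷ k ∷ p ∷ [])) c) c'
    where
    closed : Pf T Γ Δ (All num (All num (All num (All num (All num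
               (IsCode x4 x3 x2 ⇒ IsCode x4 x1 x0 ⇒ (x3 ≐ x1) ∧' (x2 ≐ x0)))))))
    closed = ∀I (∀I (∀I (∀I (∀I (⇒I (⇒I
      (∨E (<ᵗ-trichotomy (x3 `+ x2) (x1 `+ x0))
        (⊥'-elim (<ᵗ-irrefl (≐-trans (≐-sym hyp₂) hyp₁) (code-mono-diagonal x3 x2 (x1 `+ x0) x0 hyp₀)))
        (∨E hyp₀
          (have (code-injective-diagonal hyp₃ hyp₂ hyp₀)
            (∧I (+-cancelʳ (≐-trans hyp₁ (+-congˡ x1 (≐-sym hyp₀)))) hyp₀))
          (⊥'-elim (<ᵗ-irrefl (≐-trans (≐-sym hyp₂) hyp₃)
                              (code-mono-diagonal x1 x0 (x3 `+ x2) x2 hyp₀)))))))))))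

  pair∈-intro : ∀ {p t u : Tm Γ} {y : Γ ∋ set tt} →
                Pf T Γ Δ (IsCode p t u) → Pf T Γ Δ (p ∈ₛ y) → Pf T Γ Δ (pair∈ t u y)
  pair∈-intro {p = p} {t} {u} {y} c m = ∃I p (subst (Pf T _ _)
    (cong₂ (λ a b → (p `+ p ≐ (a `+ b) `* (a `+ b `+ `1) `+ b `+ b) ∧' (p ∈ₛ y))
           (sym (subT-sub0-wk p t)) (sym (subT-sub0-wk p u)))
    (∧I c m))

-- (AC!) from Δ¹₁-comprehension

module ChoiceFromΔ¹₁ {T : Theory ⊤} (ar : Ar ⊆ₜ T) (δ : Δ¹₁-C ⊆ₜ T)
                     {Γ : Ctx ⊤} (φ : Fm (set tt ∷ num ∷ Γ)) (nsq : NoSetQ φ) where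
  open Logic T
  open Arithmetic ar

  private variable
    Ξ Ξ' : Ctx ⊤
    τ : Sort ⊤
    ρ : Ren Γ Ξ
    ρ' : Ren Γ Ξ'

  -- The formulas below live in extensions Ξ of Γ; ρ : Ren Γ Ξ says where the
  -- parameters of φ sit in Ξ.
  ↑_ : Ren Γ Ξ → Ren Γ (τ ∷ Ξ)
  (↑ ρ) y = there (ρ y)

  idᵣ : Ren Γ Γ
  idᵣ y = y

  args : Ξ ∋ set tt → Tm Ξ → Ren Γ Ξ → Sub (set tt ∷ num ∷ Γ) Ξ
  args u n ρ here                      = u
  args u n ρ (there here)              = n
  args u n ρ (there (there {σ = σ} y)) = varV σ (ρ y)

  Φ : Ren Γ Ξ → Tm Ξ → Ξ ∋ set tt → Fm Ξ
  Φ ρ n u = subF (args u n ρ) φ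

  record Coherent (θ : Sub Ξ Ξ') (ρ : Ren Γ Ξ) (ρ' : Ren Γ Ξ') : Set where
    constructor coherent
    field coherence : ∀ {σ} (y : Γ ∋ σ) → θ (ρ y) ≡ varV σ (ρ' y)
  open Coherent

  Coherent-extS : {θ : Sub Ξ Ξ'} → Coherent θ ρ ρ' → Coherent (extS {τ = τ} θ) (↑ ρ) (↑ ρ')
  Coherent-extS {ρ' = ρ'} c =
    coherent (λ {σ} y → trans (cong (renV there σ) (coherence c y)) (renV-varV there σ (ρ' y)))

  Coherent-ren : (r : Ren Ξ Ξ') → Coherent (ren⇒sub r) ρ (λ y → r (ρ y))
  Coherent-ren r = coherent (λ y → refl)

  Coherent-sub0 : ∀ {σ} (v : Val Ξ σ) → Coherent (sub0 v) (↑ ρ) ρ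
  Coherent-sub0 v = coherent (λ y → refl)

  Φ-subF : (θ : Sub Ξ Ξ') → Coherent θ ρ ρ' → (n : Tm Ξ) (u : Ξ ∋ set tt) →
           subF θ (Φ ρ n u) ≡ Φ ρ' (subT θ n) (θ u)
  Φ-subF {ρ = ρ} {ρ' = ρ'} θ c n u = trans (subF-∘ θ (args u n ρ) φ) (subF-cong pointwise φ)
    where
    pointwise : θ ∘ₛ args u n ρ ≗ₛ args (θ u) (subT θ n) ρ'
    pointwise here                      = refl
    pointwise (there here)              = refl
    pointwise (there (there {σ = σ} y)) = trans (subV-varV θ σ (ρ y)) (coherence c y)

  Φ-renF : (r : Ren Ξ Ξ') (n : Tm Ξ) (u : Ξ ∋ set tt) →
           renF r (Φ ρ n u) ≡ Φ (λ y → r (ρ y)) (renT r n) (r u)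
  Φ-renF {ρ = ρ} r n u = trans (renF-as-sub r _)
    (trans (Φ-subF (ren⇒sub r) (Coherent-ren r) n u)
           (cong (λ t → Φ (λ y → r (ρ y)) t (r u)) (sym (renT-as-sub r n))))

  Φ-wk : (n : Tm Ξ) (u : Ξ ∋ set tt) → wk {τ = τ} (Φ ρ n u) ≡ Φ (↑ ρ) (renT there n) (there u)
  Φ-wk = Φ-renF there

  Φ-≐ : ∀ {a b : Tm Ξ} {w : Ξ ∋ set tt} →
        Pf T Ξ Δ (a ≐ b) → Pf T Ξ Δ (Φ ρ a w) → Pf T Ξ Δ (Φ ρ b w)
  Φ-≐ {ρ = ρ} {a = a} {b} {w} e p =
    subst (Pf T _ _) (Φ-subF (sub0 b) (Coherent-sub0 b) x0 (there w))
      (=subst (Φ (↑ ρ) x0 (there w)) e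
        (subst (Pf T _ _) (sym (Φ-subF (sub0 a) (Coherent-sub0 a) x0 (there w))) p))

  Uniq : Ren Γ Ξ → Tm Ξ → Ξ ∋ set tt → Fm Ξ
  Uniq ρ n x = All (set tt) (Φ (↑ ρ) (renT there n) here ⇒ setEq (there x) here)

  ExUniq : Ren Γ Ξ → Tm Ξ → Fm Ξ
  ExUniq ρ n = Ex (set tt) (Φ (↑ ρ) (renT there n) here ∧' Uniq (↑ ρ) (renT there n) here)

  Total : Ren Γ Ξ → Fm Ξ
  Total ρ = All num (ExUniq (↑ ρ) x0)

  -- Ψ ρ t u : t = (k,m) with φ(k,u) and m ∈ u;
  -- Φ' ρ t v : t is a code, and t = (k,m) with φ(k,v) implies m ∈ v.
  ΨBody : Ren Γ Ξ → Tm Ξ → Ξ ∋ set tt → Fm (num ∷ num ∷ Ξ)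
  ΨBody ρ t u = IsCode (wk² t) x1 x0 ∧' (Φ (↑ ↑ ρ) x1 (there (there u)) ∧' (x0 ∈ₛ there (there u)))

  Ψ : Ren Γ Ξ → Tm Ξ → Ξ ∋ set tt → Fm Ξ
  Ψ ρ t u = Ex num (Ex num (ΨBody ρ t u))

  Φ'Body : Ren Γ Ξ → Tm Ξ → Ξ ∋ set tt → Fm (num ∷ num ∷ Ξ)
  Φ'Body ρ t v = IsCode (wk² t) x1 x0 ⇒ Φ (↑ ↑ ρ) x1 (there (there v)) ⇒ x0 ∈ₛ there (there v)

  Φ' : Ren Γ Ξ → Tm Ξ → Ξ ∋ set tt → Fm Ξ
  Φ' ρ t v = Ex num (Ex num (IsCode (wk² t) x1 x0)) ∧' All num (All num (Φ'Body ρ t v))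

  ∃Ψ : Ren Γ Ξ → Tm Ξ → Fm Ξ
  ∃Ψ ρ t = Ex (set tt) (Ψ (↑ ρ) (renT there t) here)

  ∀Φ' : Ren Γ Ξ → Tm Ξ → Fm Ξ
  ∀Φ' ρ t = All (set tt) (Φ' (↑ ρ) (renT there t) here)

  Comprehends : Ren Γ Ξ → Ξ ∋ set tt → Fm Ξ
  Comprehends ρ z = All num ((x0 ∈ₛ there z) ⇔ ∃Ψ (↑ ρ) x0)

  Row : Ren Γ Ξ → Tm Ξ → Ξ ∋ set tt → Fm Ξ
  Row ρ n y = Ex (set tt)
    (Φ (↑ ρ) (renT there n) here ∧' All num ((x0 ∈ₛ v1) ⇔ pair∈ (wk² n) x0 (there (there y))))

  Rows : Ren Γ Ξ → Fm Ξ
  Rows ρ = Ex (set tt) (All num (Row (↑ ↑ ρ) x0 (there here)))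

  Φ-subF-↑ : (θ : Sub Ξ Ξ') → Coherent θ ρ ρ' → (n : Tm Ξ) →
             subF (extS {τ = set tt} θ) (Φ (↑ ρ) (renT there n) here) ≡ Φ (↑ ρ') (renT there (subT θ n)) here
  Φ-subF-↑ {ρ' = ρ'} θ c n = trans (Φ-subF (extS θ) (Coherent-extS c) (renT there n) here)
                                    (cong (λ t → Φ (↑ ρ') t here) (subT-extS-wk θ n))

  Uniq-subF : (θ : Sub Ξ Ξ') → Coherent θ ρ ρ' → (n : Tm Ξ) (x : Ξ ∋ set tt) →
              subF θ (Uniq ρ n x) ≡ Uniq ρ' (subT θ n) (θ x)
  Uniq-subF θ c n x = cong (λ F → All (set tt) (F ⇒ setEq (there (θ x)) here)) (Φ-subF-↑ θ c n)

  ExUniq-subF : (θ : Sub Ξ Ξ') → Coherent θ ρ ρ' → (n : Tm Ξ) →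
                subF θ (ExUniq ρ n) ≡ ExUniq ρ' (subT θ n)
  ExUniq-subF {ρ' = ρ'} θ c n = cong₂ (λ F G → Ex (set tt) (F ∧' G)) (Φ-subF-↑ θ c n)
    (trans (Uniq-subF (extS θ) (Coherent-extS c) (renT there n) here)
           (cong (λ t → Uniq (↑ ρ') t here) (subT-extS-wk θ n)))

  Total-subF : (θ : Sub Ξ Ξ') → Coherent θ ρ ρ' → subF θ (Total ρ) ≡ Total ρ'
  Total-subF θ c = cong (All num) (ExUniq-subF (extS θ) (Coherent-extS c) x0)

  ΨBody-subF : (θ : Sub Ξ Ξ') → Coherent θ ρ ρ' → (t : Tm Ξ) (u : Ξ ∋ set tt) →
               subF (extS (extS θ)) (ΨBody ρ t u) ≡ ΨBody ρ' (subT θ t) (θ u)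
  ΨBody-subF θ c t u =
    cong₂ (λ a F → IsCode a x1 x0 ∧' (F ∧' (x0 ∈ₛ there (there (θ u)))))
          (subT-extS²-wk θ t)
          (Φ-subF (extS (extS θ)) (Coherent-extS (Coherent-extS c)) x1 (there (there u)))

  Φ'Body-subF : (θ : Sub Ξ Ξ') → Coherent θ ρ ρ' → (t : Tm Ξ) (v : Ξ ∋ set tt) →
                subF (extS (extS θ)) (Φ'Body ρ t v) ≡ Φ'Body ρ' (subT θ t) (θ v)
  Φ'Body-subF θ c t v =
    cong₂ (λ a F → IsCode a x1 x0 ⇒ F ⇒ x0 ∈ₛ there (there (θ v)))
          (subT-extS²-wk θ t)
          (Φ-subF (extS (extS θ)) (Coherent-extS (Coherent-extS c)) x1 (there (there v)))

  Ψ-subF : (θ : Sub Ξ Ξ') → Coherent θ ρ ρ' → (t : Tm Ξ) (u : Ξ ∋ set tt) →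
           subF θ (Ψ ρ t u) ≡ Ψ ρ' (subT θ t) (θ u)
  Ψ-subF θ c t u = cong (λ F → Ex num (Ex num F)) (ΨBody-subF θ c t u)

  Φ'-subF : (θ : Sub Ξ Ξ') → Coherent θ ρ ρ' → (t : Tm Ξ) (v : Ξ ∋ set tt) →
            subF θ (Φ' ρ t v) ≡ Φ' ρ' (subT θ t) (θ v)
  Φ'-subF θ c t v = cong₂ (λ a F → Ex num (Ex num (IsCode a x1 x0)) ∧' All num (All num F))
                          (subT-extS²-wk θ t) (Φ'Body-subF θ c t v)

  ∃Ψ-subF : (θ : Sub Ξ Ξ') → Coherent θ ρ ρ' → (t : Tm Ξ) →
            subF θ (∃Ψ ρ t) ≡ ∃Ψ ρ' (subT θ t)
  ∃Ψ-subF {ρ' = ρ'} θ c t = cong (Ex (set tt))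
    (trans (Ψ-subF (extS θ) (Coherent-extS c) (renT there t) here)
           (cong (λ s → Ψ (↑ ρ') s here) (subT-extS-wk θ t)))

  ∀Φ'-subF : (θ : Sub Ξ Ξ') → Coherent θ ρ ρ' → (t : Tm Ξ) →
             subF θ (∀Φ' ρ t) ≡ ∀Φ' ρ' (subT θ t)
  ∀Φ'-subF {ρ' = ρ'} θ c t = cong (All (set tt))
    (trans (Φ'-subF (extS θ) (Coherent-extS c) (renT there t) here)
           (cong (λ s → Φ' (↑ ρ') s here) (subT-extS-wk θ t)))

  Comprehends-subF : (θ : Sub Ξ Ξ') → Coherent θ ρ ρ' → (z : Ξ ∋ set tt) →
                     subF θ (Comprehends ρ z) ≡ Comprehends ρ' (θ z)
  Comprehends-subF θ c z =
    cong (λ F → All num ((x0 ∈ₛ there (θ z)) ⇔ F)) (∃Ψ-subF (extS θ) (Coherent-extS c) x0)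

  Row-subF : (θ : Sub Ξ Ξ') → Coherent θ ρ ρ' → (n : Tm Ξ) (y : Ξ ∋ set tt) →
             subF θ (Row ρ n y) ≡ Row ρ' (subT θ n) (θ y)
  Row-subF θ c n y = cong₂ (λ F Q → Ex (set tt) (F ∧' All num ((x0 ∈ₛ v1) ⇔ Q)))
    (Φ-subF-↑ θ c n)
    (trans (pair∈-subF (extS (extS θ)) (wk² n) x0 (there (there y)))
           (cong (λ a → pair∈ a x0 (there (there (θ y)))) (subT-extS²-wk θ n)))

  Rows-subF : (θ : Sub Ξ Ξ') → Coherent θ ρ ρ' → subF θ (Rows ρ) ≡ Rows ρ'
  Rows-subF θ c = cong (λ F → Ex (set tt) (All num F))
    (Row-subF (extS (extS θ)) (Coherent-extS (Coherent-extS c)) x0 (there here))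

  Total-wk : (ρ : Ren Γ Ξ) → wk {τ = τ} (Total ρ) ≡ Total (↑ ρ)
  Total-wk ρ = trans (renF-as-sub there _) (Total-subF (ren⇒sub there) (Coherent-ren there))

  Comprehends-wk : (ρ : Ren Γ Ξ) (z : Ξ ∋ set tt) →
                   wk {τ = τ} (Comprehends ρ z) ≡ Comprehends (↑ ρ) (there z)
  Comprehends-wk ρ z = trans (renF-as-sub there _) (Comprehends-subF (ren⇒sub there) (Coherent-ren there) z)

  Rows-wk : (ρ : Ren Γ Ξ) → wk {τ = τ} (Rows ρ) ≡ Rows (↑ ρ)
  Rows-wk ρ = trans (renF-as-sub there _) (Rows-subF (ren⇒sub there) (Coherent-ren there))

  Uniq-wk : (ρ : Ren Γ Ξ) (n : Tm Ξ) (x : Ξ ∋ set tt) →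
            wk {τ = τ} (Uniq ρ n x) ≡ Uniq (↑ ρ) (renT there n) (there x)
  Uniq-wk ρ n x = trans (renF-as-sub there _)
    (trans (Uniq-subF (ren⇒sub there) (Coherent-ren there) n x)
           (cong (λ t → Uniq (↑ ρ) t (there x)) (sym (renT-as-sub there n))))

  ∃Ψ-wk : (ρ : Ren Γ Ξ) (t : Tm Ξ) → wk {τ = τ} (∃Ψ ρ t) ≡ ∃Ψ (↑ ρ) (renT there t)
  ∃Ψ-wk ρ t = trans (renF-as-sub there _)
    (trans (∃Ψ-subF (ren⇒sub there) (Coherent-ren there) t) (cong (∃Ψ (↑ ρ)) (sym (renT-as-sub there t))))

  ∀Φ'-wk : (ρ : Ren Γ Ξ) (t : Tm Ξ) → wk {τ = τ} (∀Φ' ρ t) ≡ ∀Φ' (↑ ρ) (renT there t)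
  ∀Φ'-wk ρ t = trans (renF-as-sub there _)
    (trans (∀Φ'-subF (ren⇒sub there) (Coherent-ren there) t) (cong (∀Φ' (↑ ρ)) (sym (renT-as-sub there t))))

  Row-wk : (ρ : Ren Γ Ξ) (n : Tm Ξ) (y : Ξ ∋ set tt) →
           wk {τ = τ} (Row ρ n y) ≡ Row (↑ ρ) (renT there n) (there y)
  Row-wk ρ n y = trans (renF-as-sub there _)
    (trans (Row-subF (ren⇒sub there) (Coherent-ren there) n y)
           (cong (λ t → Row (↑ ρ) t (there y)) (sym (renT-as-sub there n))))

  Total-at : Pf T Ξ Δ (Total ρ) → (n : Tm Ξ) → Pf T Ξ Δ (ExUniq ρ n)
  Total-at {ρ = ρ} p n = subst (Pf T _ _) (ExUniq-subF (sub0 n) (Coherent-sub0 {ρ = ρ} n) x0) (∀E p n)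

  Uniq-elim : ∀ {n : Tm Ξ} {x : Ξ ∋ set tt} → Pf T Ξ Δ (Uniq ρ n x) →
              (w : Ξ ∋ set tt) → Pf T Ξ Δ (Φ ρ n w) → Pf T Ξ Δ (setEq x w)
  Uniq-elim {ρ = ρ} {n = n} p w q = ⇒E (∀E p w) (subst (Pf T _ _)
    (sym (trans (Φ-subF (sub0 w) (Coherent-sub0 {ρ = ρ} w) (renT there n) here)
                (cong (λ t → Φ ρ t w) (subT-sub0-wk w n))))
    q)

  Comprehends-at : ∀ {z : Ξ ∋ set tt} → Pf T Ξ Δ (Comprehends ρ z) → (t : Tm Ξ) →
                   Pf T Ξ Δ ((t ∈ₛ z) ⇔ ∃Ψ ρ t)
  Comprehends-at {ρ = ρ} {z = z} p t =
    subst (Pf T _ _) (cong ((t ∈ₛ z) ⇔_) (∃Ψ-subF (sub0 t) (Coherent-sub0 {ρ = ρ} t) x0)) (∀E p t)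

  ∀Φ'-at : ∀ {t : Tm Ξ} → Pf T Ξ Δ (∀Φ' ρ t) → (w : Ξ ∋ set tt) → Pf T Ξ Δ (Φ' ρ t w)
  ∀Φ'-at {ρ = ρ} {t = t} p w = subst (Pf T _ _)
    (trans (Φ'-subF (sub0 w) (Coherent-sub0 {ρ = ρ} w) (renT there t) here)
           (cong (λ s → Φ' ρ s w) (subT-sub0-wk w t)))
    (∀E p w)

  subT-sub0²-wk² : (t k m : Tm Ξ) → subT (sub0 m) (subT (extS (sub0 k)) (wk² t)) ≡ t
  subT-sub0²-wk² t k m = trans
    (cong (subT (sub0 m)) (trans (subT-extS-wk (sub0 k) (renT there t)) (cong (renT there) (subT-sub0-wk k t))))
    (subT-sub0-wk m t)

  Φ-sub0² : (ρ : Ren Γ Ξ) (k m : Tm Ξ) (v : Ξ ∋ set tt) →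
            subF (sub0 m) (subF (extS (sub0 k)) (Φ (↑ ↑ ρ) x1 (there (there v)))) ≡ Φ ρ k v
  Φ-sub0² ρ k m v = trans
    (cong (subF (sub0 m)) (Φ-subF (extS (sub0 k)) (Coherent-extS (Coherent-sub0 {ρ = ρ} k)) x1 (there (there v))))
    (trans (Φ-subF (sub0 m) (Coherent-sub0 {ρ = ρ} m) (renT there k) (there v))
           (cong (λ s → Φ ρ s v) (subT-sub0-wk m k)))

  Φ'Body-at : ∀ {t : Tm Ξ} {v : Ξ ∋ set tt} → Pf T Ξ Δ (All num (All num (Φ'Body ρ t v))) →
              (k m : Tm Ξ) → Pf T Ξ Δ (IsCode t k m ⇒ Φ ρ k v ⇒ m ∈ₛ v)
  Φ'Body-at {ρ = ρ} {t = t} {v} p k m = subst (Pf T _ _)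
    (cong₂ (λ (ab : Tm _ × Tm _) F → let (a , b) = ab in IsCode a b m ⇒ F ⇒ m ∈ₛ v)
           (cong₂ _,_ (subT-sub0²-wk² t k m) (subT-sub0-wk m k)) (Φ-sub0² ρ k m v))
    (∀E (∀E p k) m)

  IsCode-∃ : ∀ {t k m : Tm Ξ} → Pf T Ξ Δ (IsCode t k m) → Pf T Ξ Δ (Ex num (Ex num (IsCode (wk² t) x1 x0)))
  IsCode-∃ {t = t} {k} {m} c = ∃I k (∃I m (subst (Pf T _ _)
    (cong₂ (λ a b → IsCode a b m) (sym (subT-sub0²-wk² t k m)) (sym (subT-sub0-wk m k))) c))

  ∃Ψ-intro : ∀ {t : Tm Ξ} (u : Ξ ∋ set tt) (k m : Tm Ξ) → Pf T Ξ Δ (IsCode t k m) →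
             Pf T Ξ Δ (Φ ρ k u) → Pf T Ξ Δ (m ∈ₛ u) → Pf T Ξ Δ (∃Ψ ρ t)
  ∃Ψ-intro {ρ = ρ} {t = t} u k m c f m∈u = ∃I u (subst (Pf T _ _)
    (sym (trans (Ψ-subF (sub0 u) (Coherent-sub0 {ρ = ρ} u) (renT there t) here)
                (cong (λ s → Ψ ρ s u) (subT-sub0-wk u t))))
    (∃I k (∃I m (subst (Pf T _ _)
      (sym (cong₂ (λ (ab : Tm _ × Tm _) F → let (a , b) = ab in IsCode a b m ∧' (F ∧' (m ∈ₛ u)))
                  (cong₂ _,_ (subT-sub0²-wk² t k m) (subT-sub0-wk m k)) (Φ-sub0² ρ k m u)))
      (∧I c (∧I f m∈u))))))

  Total-∈-wk : Total ρ ∈ Δ → Total (↑ ρ) ∈ map (wk {τ = τ}) Δ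
  Total-∈-wk {ρ = ρ} i = ∈-wk i (sym (Total-wk ρ))

  Comprehends-∈-wk : ∀ {z} → Comprehends ρ z ∈ Δ → Comprehends (↑ ρ) (there z) ∈ map (wk {τ = τ}) Δ
  Comprehends-∈-wk {ρ = ρ} {z = z} i = ∈-wk i (sym (Comprehends-wk ρ z))

  ∀Φ'-∈-wk : ∀ {t} → ∀Φ' ρ t ∈ Δ → ∀Φ' (↑ ρ) (renT there t) ∈ map (wk {τ = τ}) Δ
  ∀Φ'-∈-wk {ρ = ρ} {t = t} i = ∈-wk i (sym (∀Φ'-wk ρ t))

  Uniq-∈-wk : ∀ {n x} → Uniq ρ n x ∈ Δ → Uniq (↑ ρ) (renT there n) (there x) ∈ map (wk {τ = τ}) Δ
  Uniq-∈-wk {ρ = ρ} {n = n} {x} i = ∈-wk i (sym (Uniq-wk ρ n x))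

  Φ-∈-wk : ∀ {n u} → Φ ρ n u ∈ Δ → Φ (↑ ρ) (renT there n) (there u) ∈ map (wk {τ = τ}) Δ
  Φ-∈-wk {n = n} {u} i = ∈-wk i (sym (Φ-wk n u))

  -- Comprehension supplies some set w; Φ'(t,w) makes t = (k,m), and for the x
  -- with φ(k,x), Φ'(t,x) gives m ∈ x, that is Ψ(t,x).
  ∀Φ'⇒∃Ψ : (ρ : Ren Γ Ξ) (t : Tm Ξ) → Total ρ ∈ Δ → ∀Φ' ρ t ∈ Δ → Pf T Ξ Δ (∃Ψ ρ t)
  ∀Φ'⇒∃Ψ ρ t total ∀φ' = ∃E-≡ (ax (ar (comp ⊥' tt))) (sym (∃Ψ-wk ρ t))
    (from-set (↑ ρ) (renT there t) (Any.there (Total-∈-wk total)) (Any.there (∀Φ'-∈-wk ∀φ')) here)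
    where
    from-graph : ∀ {Ξ Δ} (ρ : Ren Γ Ξ) (t k m : Tm Ξ) (x : Ξ ∋ set tt) → ∀Φ' ρ t ∈ Δ →
                 Pf T Ξ Δ (IsCode t k m) → Pf T Ξ Δ (Φ ρ k x) → Pf T Ξ Δ (∃Ψ ρ t)
    from-graph ρ t k m x ∀φ' code graph =
      ∃Ψ-intro x k m code graph (⇒E (⇒E (Φ'Body-at (∧E₂ (∀Φ'-at (hyp ∀φ') x)) k m) code) graph)

    from-code : ∀ {Ξ Δ} (ρ : Ren Γ Ξ) (t k m : Tm Ξ) → Total ρ ∈ Δ → ∀Φ' ρ t ∈ Δ →
                IsCode t k m ∈ Δ → Pf T Ξ Δ (∃Ψ ρ t)
    from-code ρ t k m total ∀φ' code = ∃E-≡ (Total-at (hyp total) k) (sym (∃Ψ-wk ρ t))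
      (from-graph (↑ ρ) (renT there t) (renT there k) (renT there m) here
                  (Any.there (∀Φ'-∈-wk ∀φ')) (hyp (Any.there (∈-map⁺ wk code))) (∧E₁ hyp₀))

    from-set : ∀ {Ξ Δ} (ρ : Ren Γ Ξ) (t : Tm Ξ) → Total ρ ∈ Δ → ∀Φ' ρ t ∈ Δ →
               (w : Ξ ∋ set tt) → Pf T Ξ Δ (∃Ψ ρ t)
    from-set ρ t total ∀φ' w = ∃E-≡ (∧E₁ (∀Φ'-at (hyp ∀φ') w)) (sym (∃Ψ-wk ρ t))
      (∃E-≡ hyp₀ (sym (∃Ψ-wk (↑ ρ) (renT there t)))
        (from-code (↑ ↑ ρ) (wk² t) x1 x0
                   (Any.there (Total-∈-wk (Any.there (Total-∈-wk total))))
                   (Any.there (∀Φ'-∈-wk (Any.there (∀Φ'-∈-wk ∀φ')))) ∈₀))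

  -- If t = (k,m) with φ(k,u) and m ∈ u, then every decomposition t = (k',m')
  -- with φ(k',v) has k' = k and m' = m by injectivity of the pairing, and
  -- v = u by uniqueness, so m' ∈ v.
  ∃Ψ⇒∀Φ' : (ρ : Ren Γ Ξ) (t : Tm Ξ) → Total ρ ∈ Δ → ∃Ψ ρ t ∈ Δ → Pf T Ξ Δ (∀Φ' ρ t)
  ∃Ψ⇒∀Φ' ρ t total ∃ψ =
    ∃E-≡ (hyp ∃ψ) (sym (∀Φ'-wk ρ t)) (∃E-≡ hyp₀ (sym (∀Φ'-wk (↑ ρ) (renT there t)))
      (∃E-≡ hyp₀ (sym (∀Φ'-wk (↑ ↑ ρ) (wk² t)))
        (have (∧E₁ hyp₀) (have (∧E₁ (∧E₂ hyp₁)) (have (∧E₂ (∧E₂ hyp₂))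
          (∀I (Φ'-intro (↑ ↑ ↑ ↑ ρ) (renT there (wk² (renT there t))) (renT there x1) (renT there x0)
                        (there (there (there here))) here
                 (Total-∈-wk (Any.there (Any.there (Any.there
                   (Any.there (Total-∈-wk (Any.there (Total-∈-wk (Any.there (Total-∈-wk total))))))))))
                 (∈-map⁺ wk ∈₂) (Φ-∈-wk ∈₁) (∈-map⁺ wk ∈₀))))))))
    where

    transfer : ∀ {Ξ Δ} {ρ : Ren Γ Ξ} {k k' m m' : Tm Ξ} {x u v : Ξ ∋ set tt} →
               Pf T Ξ Δ (Uniq ρ k x) → Pf T Ξ Δ (Φ ρ k u) → Pf T Ξ Δ (m ∈ₛ u) →
               Pf T Ξ Δ (Φ ρ k' v) → Pf T Ξ Δ (k ≐ k') → Pf T Ξ Δ (m ≐ m') → Pf T Ξ Δ (m' ∈ₛ v)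
    transfer {m = m} {u = u} {v} uniq graph-u m∈u graph-v k≐k' m≐m' = ∈-cong m≐m'
      (⇒E (∧E₁ (∀E (Uniq-elim uniq v (Φ-≐ (≐-sym k≐k') graph-v)) m))
          (⇒E (∧E₂ (∀E (Uniq-elim uniq u graph-u) m)) m∈u))

    from-codes : ∀ {Ξ Δ} (ρ : Ren Γ Ξ) (t k m k' m' : Tm Ξ) (u v : Ξ ∋ set tt) →
                 Total ρ ∈ Δ → IsCode t k m ∈ Δ → Φ ρ k u ∈ Δ → (m ∈ₛ u) ∈ Δ →
                 IsCode t k' m' ∈ Δ → Φ ρ k' v ∈ Δ → Pf T Ξ Δ (m' ∈ₛ v)
    from-codes ρ t k m k' m' u v total code graph-u m∈u code' graph-v =
      have (code-injective (hyp code) (hyp code'))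
        (∃E-≡ (Total-at (hyp (Any.there total)) k) refl
          (transfer (∧E₂ hyp₀)
            (hyp (Any.there (Φ-∈-wk (Any.there graph-u)))) (hyp (Any.there (∈-map⁺ wk (Any.there m∈u))))
            (hyp (Any.there (Φ-∈-wk (Any.there graph-v))))
            (∧E₁ hyp₁) (∧E₂ hyp₁)))

    Φ'-intro : ∀ {Ξ Δ} (ρ : Ren Γ Ξ) (t k m : Tm Ξ) (u v : Ξ ∋ set tt) → Total ρ ∈ Δ →
               IsCode t k m ∈ Δ → Φ ρ k u ∈ Δ → (m ∈ₛ u) ∈ Δ → Pf T Ξ Δ (Φ' ρ t v)
    Φ'-intro ρ t k m u v total code graph m∈u = ∧I (IsCode-∃ (hyp code)) (∀I (∀I (⇒I (⇒I
      (from-codes (↑ ↑ ρ) (wk² t) (wk² k) (wk² m) x1 x0 (there (there u)) (there (there v))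
        (Any.there (Any.there (Total-∈-wk (Total-∈-wk total))))
        (Any.there (Any.there (∈-map⁺ wk (∈-map⁺ wk code))))
        (Any.there (Any.there (Φ-∈-wk (Φ-∈-wk graph))))
        (Any.there (Any.there (∈-map⁺ wk (∈-map⁺ wk m∈u))))
        ∈₁ ∈₀)))))

  -- For the x with φ(n,x): m ∈ x gives Ψ((n,m),x), hence (n,m) ∈ z; conversely
  -- (n,m) ∈ z gives some u with φ(n,u) and m ∈ u, and u = x by uniqueness.
  Row-intro : (ρ : Ren Γ Ξ) (n : Tm Ξ) (z : Ξ ∋ set tt) → Comprehends ρ z ∈ Δ → Total ρ ∈ Δ →
              Pf T Ξ Δ (Row ρ n z)
  Row-intro {Ξ = Ξ} ρ n z zdef total =
    ∃E-≡ (Total-at (hyp total) n) (sym (Row-wk ρ n z)) (have (∧E₁ hyp₀) (have (∧E₂ hyp₁)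
      (∃I here (subst (Pf T _ _) (sym instance-eq) (∧I hyp₁ (∀I (∧I
        (⇒I (∃E-≡ (code-exists n₂ x0) (sym (pair∈-wk n₂ x0 z₂))
          (pair∈-intro hyp₀ (into-z (↑ ↑ ↑ ρ) (there z₂) x0 (renT there n₂) x1 (there (there here))
            (Any.there (Comprehends-∈-wk (Any.there (Comprehends-∈-wk
              (Any.there (Any.there (Any.there (Comprehends-∈-wk zdef)))))))) hyp₀
            (hyp (Any.there (Φ-∈-wk (Any.there (Φ-∈-wk ∈₁))))) hyp₁))))
        (⇒I (∃E hyp₀ (have (∧E₁ hyp₀) (have (∧E₂ hyp₁)
          (out-of-z (↑ ↑ ↑ ρ) (there z₂) x0 (renT there n₂) x1 (there (there here))
            (Any.there (Any.there (Any.there (Comprehends-∈-wk (Any.there (Comprehends-∈-wk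
              (Any.there (Any.there (Any.there (Comprehends-∈-wk zdef))))))))))
            (Any.there (Any.there (Any.there (Uniq-∈-wk (Any.there (Uniq-∈-wk ∈₀))))))
            ∈₁ ∈₀))))))))))))
    where
    n₁ : Tm (set tt ∷ Ξ)
    n₁ = renT there n
    n₂ : Tm (num ∷ set tt ∷ Ξ)
    n₂ = renT there n₁
    z₂ : num ∷ set tt ∷ Ξ ∋ set tt
    z₂ = there (there z)

    instance-eq : subF (sub0 here) (Φ (↑ ↑ ρ) (renT there n₁) here ∧'
                                    All num ((x0 ∈ₛ v1) ⇔ pair∈ (wk² n₁) x0 (there (there (there z)))))
                  ≡ (Φ (↑ ρ) n₁ here ∧' All num ((x0 ∈ₛ there here) ⇔ pair∈ n₂ x0 z₂))
    instance-eq = cong₂ (λ F Q → F ∧' All num ((x0 ∈ₛ there here) ⇔ Q))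
      (trans (Φ-subF (sub0 here) (Coherent-sub0 {ρ = ↑ ρ} here) (renT there n₁) here)
             (cong (λ s → Φ (↑ ρ) s here) (subT-sub0-wk here n₁)))
      (trans (pair∈-subF (extS (sub0 here)) (wk² n₁) x0 (there (there (there z))))
             (cong (λ a → pair∈ a x0 z₂)
                   (trans (subT-extS-wk (sub0 here) (renT there n₁)) (cong (renT there) (subT-sub0-wk here n₁)))))

    into-z : ∀ {Ξ Δ} (ρ : Ren Γ Ξ) (z : Ξ ∋ set tt) (p n m : Tm Ξ) (x : Ξ ∋ set tt) →
             Comprehends ρ z ∈ Δ → Pf T Ξ Δ (IsCode p n m) → Pf T Ξ Δ (Φ ρ n x) →
             Pf T Ξ Δ (m ∈ₛ x) → Pf T Ξ Δ (p ∈ₛ z)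
    into-z ρ z p n m x zdef code graph m∈x =
      ⇒E (∧E₂ (Comprehends-at (hyp zdef) p)) (∃Ψ-intro x n m code graph m∈x)

    out-of-z : ∀ {Ξ Δ} (ρ : Ren Γ Ξ) (z : Ξ ∋ set tt) (p n m : Tm Ξ) (x : Ξ ∋ set tt) →
               Comprehends ρ z ∈ Δ → Uniq ρ n x ∈ Δ → IsCode p n m ∈ Δ → (p ∈ₛ z) ∈ Δ →
               Pf T Ξ Δ (m ∈ₛ x)
    out-of-z ρ z p n m x zdef uniq code p∈z =
      ∃E (⇒E (∧E₁ (Comprehends-at (hyp zdef) p)) (hyp p∈z)) (∃E hyp₀ (∃E hyp₀
        (have (code-injective
                (hyp (Any.there (∈-map⁺ wk (Any.there (∈-map⁺ wk (Any.there (∈-map⁺ wk code)))))))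
                (∧E₁ hyp₀))
          (∈-cong (≐-sym (∧E₂ hyp₀))
            (⇒E (∧E₂ (∀E (Uniq-elim
                            (hyp (Any.there (Any.there (Uniq-∈-wk (Any.there (Uniq-∈-wk
                                   (Any.there (Uniq-∈-wk uniq))))))))
                            (there (there here)) (Φ-≐ (≐-sym (∧E₁ hyp₀)) (∧E₁ (∧E₂ hyp₁))))
                         x0))
                (∧E₂ (∧E₂ hyp₁)))))))

  Rows-intro : (ρ : Ren Γ Ξ) (z : Ξ ∋ set tt) → Comprehends ρ z ∈ Δ → Total ρ ∈ Δ →
               Pf T Ξ Δ (Rows ρ)
  Rows-intro ρ z zdef total = ∃I z (subst (Pf T _ _)
    (cong (All num) (sym (Row-subF (extS (sub0 z)) (Coherent-extS (Coherent-sub0 {ρ = ρ} z)) x0 (there here))))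
    (∀I (Row-intro (↑ ρ) x0 (there z) (Comprehends-∈-wk zdef) (Total-∈-wk total))))

  φ-as-Φ : φ ≡ Φ (↑ ↑ idᵣ) x1 here
  φ-as-Φ = sym (subF-id pointwise φ)
    where
    pointwise : args here x1 (↑ ↑ idᵣ) ≗ₛ idₛ
    pointwise here                      = refl
    pointwise (there here)              = refl
    pointwise (there (there {σ = σ} y)) = refl

  ExU-as-Total : All num (ExU tt φ) ≡ Total idᵣ
  ExU-as-Total = cong₂ (λ F G → All num (Ex (set tt) (F ∧' All (set tt) (G ⇒ setEq v1 v0))))
    φ-as-Φ (trans (cong (renF skip1) φ-as-Φ) (Φ-renF skip1 x1 here))

  Φ'₀ Ψ₀ : Fm (set tt ∷ num ∷ Γ)
  Φ'₀ = Φ' (↑ ↑ idᵣ) x1 here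
  Ψ₀  = Ψ (↑ ↑ idᵣ) x1 here

  NoSetQ-Φ'₀ : NoSetQ Φ'₀
  NoSetQ-Φ'₀ = tt , (tt , (NoSetQ-subF _ φ nsq , tt))

  NoSetQ-Ψ₀ : NoSetQ Ψ₀
  NoSetQ-Ψ₀ = tt , (NoSetQ-subF _ φ nsq , tt)

  comprehension-as-Comprehends :
    All num ((var v0 ∈ₛ v1) ⇔ Ex (set tt) (renF (ext (ext there)) Ψ₀)) ≡ Comprehends (↑ idᵣ) here
  comprehension-as-Comprehends = cong (λ F → All num ((var v0 ∈ₛ v1) ⇔ Ex (set tt) F))
    (trans (renF-as-sub (ext (ext there)) Ψ₀)
           (Ψ-subF (ren⇒sub (ext (ext there))) (Coherent-ren (ext (ext there))) x1 here))

  choice-conclusion-as-Rows :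
    Ex (set tt) (All num (Ex (set tt) (renF (ext (ext there)) φ ∧'
      All num ((var v0 ∈ₛ v1) ⇔ pair∈ (var (there (there here))) (var v0) (there (there (there here)))))))
    ≡ Rows idᵣ
  choice-conclusion-as-Rows = cong (λ F → Ex (set tt) (All num (Ex (set tt) (F ∧'
      All num ((var v0 ∈ₛ v1) ⇔ pair∈ (var (there (there here))) (var v0) (there (there (there here))))))))
    (trans (cong (renF (ext (ext there))) φ-as-Φ) (Φ-renF (ext (ext there)) x1 here))

  -- Δ¹₁-comprehension for ∀v Φ'₀ ≡ ∃u Ψ₀ gives z = {t | ∃u Ψ₀(t,u)}, which is the choice set.
  choice-derivable : Pf T Γ Δ (Choice tt tt φ)
  choice-derivable {Δ = Δ} =
    ⇒I (∃E (⇒E (ax (δ (d11 Φ'₀ Ψ₀ NoSetQ-Φ'₀ NoSetQ-Ψ₀))) Δ¹₁-premise)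
          (subst (Pf T _ _) (sym (trans (cong wk choice-conclusion-as-Rows) (Rows-wk idᵣ)))
                 (Rows-intro (↑ idᵣ) here (Any.here (sym comprehension-as-Comprehends))
                             (Any.there (Total-∈-wk total)))))
    where
    total : Total idᵣ ∈ All num (ExU tt φ) ∷ Δ
    total = Any.here (sym ExU-as-Total)

    Δ¹₁-premise : Pf T Γ (All num (ExU tt φ) ∷ Δ) (All num (All (set tt) Φ'₀ ⇔ Ex (set tt) Ψ₀))
    Δ¹₁-premise = ∀I (∧I (⇒I (∀Φ'⇒∃Ψ (↑ idᵣ) x0 (Any.there (Total-∈-wk total)) ∈₀))
                         (⇒I (∃Ψ⇒∀Φ' (↑ idᵣ) x0 (Any.there (Total-∈-wk total)) ∈₀)))

module _ {S : Set} {T U : Theory S} (axiom : ∀ {Γ Δ φ} → T Γ φ → Pf U Γ Δ φ) where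

  replace-axioms : ∀ {Γ Δ φ} → Pf T Γ Δ φ → Pf U Γ Δ φ
  replace-axioms (ax a)         = axiom a
  replace-axioms (hyp m)        = hyp m
  replace-axioms (⇒I p)         = ⇒I (replace-axioms p)
  replace-axioms (⇒E p q)       = ⇒E (replace-axioms p) (replace-axioms q)
  replace-axioms (∧I p q)       = ∧I (replace-axioms p) (replace-axioms q)
  replace-axioms (∧E₁ p)        = ∧E₁ (replace-axioms p)
  replace-axioms (∧E₂ p)        = ∧E₂ (replace-axioms p)
  replace-axioms (∨I₁ p)        = ∨I₁ (replace-axioms p)
  replace-axioms (∨I₂ p)        = ∨I₂ (replace-axioms p)
  replace-axioms (∨E p q r)     = ∨E (replace-axioms p) (replace-axioms q) (replace-axioms r)
  replace-axioms (raa p)        = raa (replace-axioms p)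
  replace-axioms (∀I p)         = ∀I (replace-axioms p)
  replace-axioms (∀E p v)       = ∀E (replace-axioms p) v
  replace-axioms (∃I v p)       = ∃I v (replace-axioms p)
  replace-axioms (∃E p q)       = ∃E (replace-axioms p) (replace-axioms q)
  replace-axioms (=refl t)      = =refl t
  replace-axioms (=subst φ p q) = =subst φ (replace-axioms p) (replace-axioms q)

Ar+AC!⇒Ar+Δ¹₁-C : ∀ {Γ Δ φ} → (Ar +ₜ AC!) Γ φ → Pf (Ar +ₜ Δ¹₁-C) Γ Δ φ
Ar+AC!⇒Ar+Δ¹₁-C (inj₁ a)        = ax (inj₁ a)
Ar+AC!⇒Ar+Δ¹₁-C (inj₂ (ac φ n)) = ChoiceFromΔ¹₁.choice-derivable inj₁ inj₂ φ n

theorem5 : ((Γ : Ctx ℕ) (φ : Fm Γ) → SA ⊢ φ → (Ar +ₜ AC!) ⊢ ((close Γ φ) ^))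
         × ((Γ : Ctx ⊤) (φ : Fm Γ) → (Ar +ₜ AC!) ⊢ φ → (Ar +ₜ Δ¹₁-C) ⊢ φ)
theorem5 = (λ Γ φ p → close-erase Γ φ (erase-Pf SA⇒Ar+AC! p))
         , (λ Γ φ → replace-axioms Ar+AC!⇒Ar+Δ¹₁-C)
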